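{- Let $(d,n)\in\mathbb{N}^2$ and let $w$ be any word with exactly $d$ letters $a$ and $n$ letters $b$ (i.e. a lattice path from $(0,0)$ to $(d,n)$). Then $m(w)\ge m(c(n,d))$. Moreover, when $d,n\ge1$, writing $\delta=\gcd(d,n)$ and writing the (primitive) lower Christoffel word of slope $n/d$ as $a\,p\,b$ with $p$ a palindrome, equality $m(w)=m(c(n,d))$ holds if and only if either $w=c(n,d)=(a p b)^{\delta}$, or $\delta\ge2$ and $w=(a p a)(b p a)^{\delta-2}(b p b)$.
   Context: Words are finite words over $\{a,b\}$. Let $A=\begin{pmatrix}1&1\\1&2\end{pmatrix}$, $B=\begin{pmatrix}2&1\\1&1\end{pmatrix}$, and for $w=x_1\cdots x_k$ let $M^w=M^{x_1}\cdots M^{x_k}$ with $M^a=A$, $M^b=B$ ($M^w=I$ for the empty word). The $m$-value is $m(w)=\begin{pmatrix}1&0\end{pmatrix}M^w\begin{pmatrix}0\\1\end{pmatrix}$. A word is identified with the lattice path from $(0,0)$ with $a$ = step $(1,0)$, $b$ = step $(0,1)$. For coprime $u,v\in\mathbb{N}$, the lower Christoffel word of slope $v/u$ is the lattice path from $(0,0)$ to $(u,v)$ lying below the segment joining these points such that the region between path and segment contains no lattice points other than those of the path and segment; for $u,v\ge1$ it has the form $a\,p\,b$ with $p$ a palindrome. For $(d,n)\in\mathbb{N}^2$, $c(n,d)$ is the unique lattice path from $(0,0)$ to $(d,n)$ lying weakly below the segment from $(0,0)$ to $(d,n)$, containing every lattice point of this segment, and such that the region between the path and the segment contains no points of $\mathbb{N}^2$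 other than those of the path; equivalently $c(n,d)$ is the $\gcd(d,n)$-th power of the lower Christoffel word of slope $n/d$. -}

module Defs where

open import Data.Nat using (ℕ; zero; suc; _+_; _*_; _≤_)
open import Data.List using (List; []; _∷_; _++_; inits; reverse; replicate; concat)
open import Data.List.Relation.Unary.Any using (Any)
open import Data.Product using (_×_)
open import Relation.Binary.PropositionalEquality using (_≡_)

data Letter : Set where
  a b : Letter

Word : Set
Word = List Letter

record Mat : Set where
  constructor mat
  field
    m11 m12 m21 m22 : ℕ
open Mat public

_⊗_ : Mat → Mat → Mat
mat x11 x12 x21 x22 ⊗ mat y11 y12 y21 y22 =
  mat (x11 * y11 + x12 * y21) (x11 * y12 + x12 * y22)
      (x21 * y11 + x22 * y21) (x21 * y12 + x22 * y22)

I₂ : Mat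
I₂ = mat 1 0 0 1

Aₘ : Mat
Aₘ = mat 1 1 1 2

Bₘ : Mat
Bₘ = mat 2 1 1 1

Mˡ : Letter → Mat
Mˡ a = Aₘ
Mˡ b = Bₘ

Mʷ : Word → Mat
Mʷ [] = I₂
Mʷ (x ∷ w) = Mˡ x ⊗ Mʷ w

-- m(w) = (1 0) M^w (0 1)ᵀ, the top-right entry
mval : Word → ℕ
mval w = m12 (Mʷ w)

#a : Word → ℕ
#a [] = 0
#a (a ∷ w) = suc (#a w)
#a (b ∷ w) = #a w

#b : Word → ℕ
#b [] = 0
#b (a ∷ w) = #b w
#b (b ∷ w) = suc (#b w)

-- (x , y) is a vertex of the lattice path of w (a = (1,0), b = (0,1))
OnPath : Word → ℕ → ℕ → Set
OnPath w x y = Any (λ q → #a q ≡ x × #b q ≡ y) (inits w)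

-- IsC d n c : c is the lattice path c(n,d) from (0,0) to (d,n) lying weakly
-- below the segment (0,0)–(d,n), containing every lattice point of the
-- segment, and such that the region between path and segment contains no
-- points of ℕ² other than those of the path.
-- (For coprime d,n this is exactly the lower Christoffel word of slope n/d.)
record IsC (d n : ℕ) (c : Word) : Set where
  field
    ends   : #a c ≡ d × #b c ≡ n
    below  : ∀ x y → OnPath c x y → y * d ≤ x * n
    segPts : ∀ x y → x ≤ d → y ≤ n → y * d ≡ x * n → OnPath c x y
    -- a lattice point (x,y) weakly below the segment and (within the
    -- bounding box) weakly above the path at column x lies on the path
    empty  : ∀ x y y₀ → x ≤ d → y ≤ n → y * d ≤ x * n →
             OnPath c x y₀ → y₀ ≤ y → OnPath c x y

Palindrome : Word → Set
Palindrome p = reverse p ≡ p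

_^ʷ_ : Word → ℕ → Word
w ^ʷ k = concat (replicate k w)

module Submission where

-- An improving swap ab ↔ ba changes m by 2 (Qₘ − Pₘ), and the sign of Qₘ − Pₘ can be read off
-- combinatorially by comparing the word left of the swap (read backwards) with the word right of it.
-- Descent along improving swaps therefore ends in a locally minimal word with the same letter counts.
-- Local minimality is reflected by the Christoffel morphisms G (b ↦ ab) and D (a ↦ ab) and preserved
-- by the reverse-complement mirror; a locally minimal word with factors aa and bb is aa (ba)ⁱ bb,
-- and one without bb (resp. aa) is G (resp. D) of a shorter locally minimal word. So every locally
-- minimal word is (a p b)^δ or (a p a)(b p a)^(δ−2)(b p b) for a Christoffel word a p b built along
-- the Stern–Brocot tree; both have the same m, as m (a z b) is invariant under reversing z.
-- Finally c(n,d) is the greedy lower path, which is (a p b)^δ.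

open import Defs
open import Data.Empty using (⊥-elim)
open import Data.List using ([]; _∷_; _++_; [_]; reverse; replicate; length; inits)
open import Data.List.Properties
  using (++-assoc; ++-identityʳ; ++-cancelˡ; ++-cancelʳ; reverse-++; unfold-reverse; reverse-involutive;
         ∷-injective; ∷-injectiveˡ; ∷-injectiveʳ)
open import Data.List.Relation.Unary.Any using (Any; here; there)
open import Data.List.Relation.Unary.Any.Properties using (map⁺; map⁻)
open import Data.Nat
open import Data.Nat.Properties
open import Data.Nat.GCD using (gcd; c*gcd[m,n]≡gcd[cm,cn]; gcd-zeroˡ)
open import Data.Nat.Coprimality as Coprimality using (Coprime; coprime-+; coprime⇒gcd≡1; gcd≡1⇒coprime)
open import Data.Nat.Tactic.RingSolver using (solve-∀)
open import Data.Product
open import Data.Sum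
open import Function using (_∘_; case_of_)
open import Function.Bundles using (_⇔_; mk⇔; Equivalence)
open import Relation.Binary.Definitions using (tri<; tri≈; tri>)
open import Relation.Binary.PropositionalEquality hiding ([_])
open import Relation.Nullary using (¬_; Dec; yes; no)

mat-cong : ∀ {x₁ x₂ x₃ x₄ y₁ y₂ y₃ y₄} → x₁ ≡ y₁ → x₂ ≡ y₂ → x₃ ≡ y₃ → x₄ ≡ y₄ →
           mat x₁ x₂ x₃ x₄ ≡ mat y₁ y₂ y₃ y₄
mat-cong refl refl refl refl = refl

⊗-assoc : ∀ X Y Z → (X ⊗ Y) ⊗ Z ≡ X ⊗ (Y ⊗ Z)
⊗-assoc (mat x₁ x₂ x₃ x₄) (mat y₁ y₂ y₃ y₄) (mat z₁ z₂ z₃ z₄) =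
  mat-cong (entry x₁ x₂ y₁ y₂ y₃ y₄ z₁ z₃) (entry x₁ x₂ y₁ y₂ y₃ y₄ z₂ z₄)
           (entry x₃ x₄ y₁ y₂ y₃ y₄ z₁ z₃) (entry x₃ x₄ y₁ y₂ y₃ y₄ z₂ z₄)
  where
  entry : ∀ p q r s t u v w → (p * r + q * t) * v + (p * s + q * u) * w ≡
                              p * (r * v + s * w) + q * (t * v + u * w)
  entry = solve-∀

⊗-identityˡ : ∀ X → I₂ ⊗ X ≡ X
⊗-identityˡ (mat x₁ x₂ x₃ x₄) =
  mat-cong (trans (+-identityʳ _) (+-identityʳ x₁)) (trans (+-identityʳ _) (+-identityʳ x₂))
           (+-identityʳ x₃) (+-identityʳ x₄)

Mʷ-++ : ∀ x y → Mʷ (x ++ y) ≡ Mʷ x ⊗ Mʷ y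
Mʷ-++ []      y = sym (⊗-identityˡ (Mʷ y))
Mʷ-++ (l ∷ x) y = trans (cong (Mˡ l ⊗_) (Mʷ-++ x y)) (sym (⊗-assoc (Mˡ l) (Mʷ x) (Mʷ y)))

Mʷ-∷ʳ : ∀ x l → Mʷ (x ++ [ l ]) ≡ Mʷ x ⊗ Mˡ l
Mʷ-∷ʳ x a = Mʷ-++ x [ a ]
Mʷ-∷ʳ x b = Mʷ-++ x [ b ]

Mʷ-reverse-∷ : ∀ u l → Mʷ (reverse (l ∷ u)) ≡ Mʷ (reverse u) ⊗ Mˡ l
Mʷ-reverse-∷ u l = trans (cong Mʷ (unfold-reverse l u)) (Mʷ-∷ʳ (reverse u) l)

DiagonalPos : Mat → Set
DiagonalPos X = 1 ≤ m11 X × 1 ≤ m22 X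

≤-*+ : ∀ k x y → x ≤ suc k * x + y
≤-*+ k x y = ≤-trans (m≤m+n x (k * x)) (m≤m+n _ y)

≤-+* : ∀ x k y → y ≤ x + suc k * y
≤-+* x k y = ≤-trans (m≤m+n y (k * y)) (m≤n+m _ x)

Mˡ⊗-diagonalPos : ∀ l X → DiagonalPos X → DiagonalPos (Mˡ l ⊗ X)
Mˡ⊗-diagonalPos a (mat x₁ x₂ x₃ x₄) (p₁ , p₄) = ≤-trans p₁ (≤-*+ 0 x₁ _) , ≤-trans p₄ (≤-+* (1 * x₂) 1 x₄)
Mˡ⊗-diagonalPos b (mat x₁ x₂ x₃ x₄) (p₁ , p₄) = ≤-trans p₁ (≤-*+ 1 x₁ _) , ≤-trans p₄ (≤-+* (1 * x₂) 0 x₄)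

Mʷ-diagonalPos : ∀ w → DiagonalPos (Mʷ w)
Mʷ-diagonalPos []      = ≤-refl , ≤-refl
Mʷ-diagonalPos (l ∷ w) = Mˡ⊗-diagonalPos l (Mʷ w) (Mʷ-diagonalPos w)

m11-pos : ∀ w → 1 ≤ m11 (Mʷ w)
m11-pos w = proj₁ (Mʷ-diagonalPos w)

m22-pos : ∀ w → 1 ≤ m22 (Mʷ w)
m22-pos w = proj₂ (Mʷ-diagonalPos w)

m12-Mˡ⊗-pos : ∀ l X → 1 ≤ m22 X → 1 ≤ m12 (Mˡ l ⊗ X)
m12-Mˡ⊗-pos a (mat x₁ x₂ x₃ x₄) p₄ = ≤-trans p₄ (≤-+* (1 * x₂) 0 x₄)
m12-Mˡ⊗-pos b (mat x₁ x₂ x₃ x₄) p₄ = ≤-trans p₄ (≤-+* (2 * x₂) 0 x₄)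

m12-⊗Mˡ-pos : ∀ X l → 1 ≤ m11 X → 1 ≤ m12 (X ⊗ Mˡ l)
m12-⊗Mˡ-pos (mat x₁ x₂ x₃ x₄) a p₁ = ≤-trans p₁ (≤-trans (≤-reflexive (sym (*-identityʳ x₁))) (m≤m+n _ _))
m12-⊗Mˡ-pos (mat x₁ x₂ x₃ x₄) b p₁ = ≤-trans p₁ (≤-trans (≤-reflexive (sym (*-identityʳ x₁))) (m≤m+n _ _))

-- The swap lemma

Pₘ Qₘ : Mat → Mat → ℕ
Pₘ X Y = m12 X * m12 Y
Qₘ X Y = m11 X * m22 Y

-- m (x ba y) − m (x ab y) = 2 (Qₘ − Pₘ) at (Mʷ x, Mʷ y), stated without subtraction.
swap-identity : ∀ x y → mval (x ++ a ∷ b ∷ y) + 2 * Qₘ (Mʷ x) (Mʷ y) ≡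
                        mval (x ++ b ∷ a ∷ y) + 2 * Pₘ (Mʷ x) (Mʷ y)
swap-identity x y rewrite Mʷ-++ x (a ∷ b ∷ y) | Mʷ-++ x (b ∷ a ∷ y) = go (Mʷ x) (Mʷ y)
  where
  go : ∀ X Y → m12 (X ⊗ (Aₘ ⊗ (Bₘ ⊗ Y))) + 2 * Qₘ X Y ≡
               m12 (X ⊗ (Bₘ ⊗ (Aₘ ⊗ Y))) + 2 * Pₘ X Y
  go (mat x₁ x₂ _ _) (mat _ y₂ _ y₄) = entry x₁ x₂ y₂ y₄
    where
    entry : ∀ x₁ x₂ y₂ y₄ →
      x₁ * (1 * (2 * y₂ + 1 * y₄) + 1 * (1 * y₂ + 1 * y₄)) +
      x₂ * (1 * (2 * y₂ + 1 * y₄) + 2 * (1 * y₂ + 1 * y₄)) + 2 * (x₁ * y₄) ≡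
      x₁ * (2 * (1 * y₂ + 1 * y₄) + 1 * (1 * y₂ + 2 * y₄)) +
      x₂ * (1 * (1 * y₂ + 1 * y₄) + 1 * (1 * y₂ + 2 * y₄)) + 2 * (x₂ * y₂)
    entry = solve-∀

Pₘ-Qₘ-step : ∀ l X Y → Pₘ (X ⊗ Mˡ l) (Mˡ l ⊗ Y) + Qₘ X Y ≡
                       Pₘ X Y + Qₘ (X ⊗ Mˡ l) (Mˡ l ⊗ Y)
Pₘ-Qₘ-step a (mat x₁ x₂ _ _) (mat _ y₂ _ y₄) = entry x₁ x₂ y₂ y₄
  where
  entry : ∀ x₁ x₂ y₂ y₄ → (x₁ * 1 + x₂ * 2) * (1 * y₂ + 1 * y₄) + x₁ * y₄ ≡
                          x₂ * y₂ + (x₁ * 1 + x₂ * 1) * (1 * y₂ + 2 * y₄)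
  entry = solve-∀
Pₘ-Qₘ-step b (mat x₁ x₂ _ _) (mat _ y₂ _ y₄) = entry x₁ x₂ y₂ y₄
  where
  entry : ∀ x₁ x₂ y₂ y₄ → (x₁ * 1 + x₂ * 1) * (2 * y₂ + 1 * y₄) + x₁ * y₄ ≡
                          x₂ * y₂ + (x₁ * 2 + x₂ * 1) * (1 * y₂ + 1 * y₄)
  entry = solve-∀

Pₘ-ab : ∀ X Y → Pₘ (X ⊗ Aₘ) (Bₘ ⊗ Y) ≡
                 Qₘ (X ⊗ Aₘ) (Bₘ ⊗ Y) + (m11 X * m12 Y + 3 * Pₘ X Y + m12 X * m22 Y)
Pₘ-ab (mat x₁ x₂ _ _) (mat _ y₂ _ y₄) = entry x₁ x₂ y₂ y₄
  where
  entry : ∀ x₁ x₂ y₂ y₄ → (x₁ * 1 + x₂ * 2) * (2 * y₂ + 1 * y₄) ≡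
                          (x₁ * 1 + x₂ * 1) * (1 * y₂ + 1 * y₄) + (x₁ * y₂ + 3 * (x₂ * y₂) + x₂ * y₄)
  entry = solve-∀

Qₘ-ba : ∀ X Y → Qₘ (X ⊗ Bₘ) (Aₘ ⊗ Y) ≡
                 Pₘ (X ⊗ Bₘ) (Aₘ ⊗ Y) + (m11 X * m12 Y + 3 * Qₘ X Y + m12 X * m22 Y)
Qₘ-ba (mat x₁ x₂ _ _) (mat _ y₂ _ y₄) = entry x₁ x₂ y₂ y₄
  where
  entry : ∀ x₁ x₂ y₂ y₄ → (x₁ * 2 + x₂ * 1) * (1 * y₂ + 2 * y₄) ≡
                          (x₁ * 1 + x₂ * 1) * (1 * y₂ + 1 * y₄) + (x₁ * y₂ + 3 * (x₁ * y₄) + x₂ * y₄)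
  entry = solve-∀

+-trade-< : ∀ {m m′ r r′} → m + r ≡ m′ + r′ → r < r′ → m′ < m
+-trade-< {m} {m′} {r} {r′} eq r<r′ = +-cancelʳ-< r′ m′ m (begin-strict
  m′ + r′ ≡⟨ sym eq ⟩
  m + r   <⟨ +-monoʳ-< m r<r′ ⟩
  m + r′  ∎)
  where open ≤-Reasoning

data Sign : Set where
  neg zer pos : Sign

-- sign (reverse x) y reads x backwards and y forwards in parallel; its value is the sign of
-- Pₘ − Qₘ at (Mʷ x, Mʷ y) (sign-sound).
signᵃᵇ : Word → Word → Sign
signᵃᵇ []      []      = zer
signᵃᵇ []      (_ ∷ _) = pos
signᵃᵇ (_ ∷ _) _       = pos

sign : Word → Word → Sign
sign []      _       = neg
sign (_ ∷ _) []      = neg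
sign (a ∷ u) (a ∷ y) = sign u y
sign (b ∷ u) (b ∷ y) = sign u y
sign (a ∷ u) (b ∷ y) = signᵃᵇ u y
sign (b ∷ u) (a ∷ y) = neg

SignSound : Word → Word → Set
SignSound u y = (sign u y ≡ pos → Qₘ X Y < Pₘ X Y) × (sign u y ≡ neg → Pₘ X Y < Qₘ X Y)
  where
  X = Mʷ (reverse u)
  Y = Mʷ y

shared-letter : ∀ l u y →
  let X = Mʷ (reverse u); Y = Mʷ y; X′ = Mʷ (reverse (l ∷ u)); Y′ = Mʷ (l ∷ y) in
  (Qₘ X Y < Pₘ X Y → Qₘ X′ Y′ < Pₘ X′ Y′) × (Pₘ X Y < Qₘ X Y → Pₘ X′ Y′ < Qₘ X′ Y′)
shared-letter l u y rewrite Mʷ-reverse-∷ u l =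
    +-trade-< (trans step (+-comm (Pₘ X Y) (Qₘ X′ Y′)))
  , +-trade-< (trans (+-comm (Qₘ X′ Y′) (Pₘ X Y)) (sym step))
  where
  X  = Mʷ (reverse u)
  Y  = Mʷ y
  X′ = X ⊗ Mˡ l
  Y′ = Mˡ l ⊗ Y
  step = Pₘ-Qₘ-step l X Y

ab-margin-pos : ∀ u y → signᵃᵇ u y ≡ pos →
  let X = Mʷ (reverse u); Y = Mʷ y in 0 < m11 X * m12 Y + 3 * Pₘ X Y + m12 X * m22 Y
ab-margin-pos [] (l ∷ y) _ =
  ≤-trans (*-mono-≤ (m11-pos []) (m12-Mˡ⊗-pos l (Mʷ y) (m22-pos y))) (≤-trans (m≤m+n _ _) (m≤m+n _ _))
ab-margin-pos (l ∷ u) y _ = ≤-trans (*-mono-≤ m12-pos (m22-pos y)) (m≤n+m _ _)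
  where
  m12-pos : 1 ≤ m12 (Mʷ (reverse (l ∷ u)))
  m12-pos = subst (λ Z → 1 ≤ m12 Z) (sym (Mʷ-reverse-∷ u l))
                  (m12-⊗Mˡ-pos (Mʷ (reverse u)) l (m11-pos (reverse u)))

ba-margin-pos : ∀ x y → let X = Mʷ x; Y = Mʷ y in 0 < m11 X * m12 Y + 3 * Qₘ X Y + m12 X * m22 Y
ba-margin-pos x y = ≤-trans (*-mono-≤ (m11-pos x) (m22-pos y))
  (≤-trans (m≤m+n Q (Q + (Q + 0))) (≤-trans (m≤n+m (3 * Q) (m11 X * m12 Y)) (m≤m+n _ (m12 X * m22 Y))))
  where
  X = Mʷ x
  Y = Mʷ y
  Q = Qₘ X Y

sign-sound : ∀ u y → SignSound u y
sign-sound []      y  = (λ ()) , λ _ → ≤-trans (m22-pos y) (≤-reflexive (sym (+-identityʳ _)))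
sign-sound (l ∷ u) [] = (λ ()) , λ _ →
  subst₂ _≤_ (cong suc (sym (*-zeroʳ (m12 (Mʷ (reverse (l ∷ u))))))) (sym (*-identityʳ _)) (m11-pos (reverse (l ∷ u)))
sign-sound (a ∷ u) (a ∷ y) = let ih = sign-sound u y; step = shared-letter a u y in
  proj₁ step ∘ proj₁ ih , proj₂ step ∘ proj₂ ih
sign-sound (b ∷ u) (b ∷ y) = let ih = sign-sound u y; step = shared-letter b u y in
  proj₁ step ∘ proj₁ ih , proj₂ step ∘ proj₂ ih
sign-sound (a ∷ u) (b ∷ y) = ab-pos , λ s → ⊥-elim (signᵃᵇ≢neg u y s)
  where
  signᵃᵇ≢neg : ∀ u y → signᵃᵇ u y ≢ neg
  signᵃᵇ≢neg [] [] ()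
  signᵃᵇ≢neg [] (_ ∷ _) ()
  signᵃᵇ≢neg (_ ∷ _) _ ()
  ab-pos : sign (a ∷ u) (b ∷ y) ≡ pos →
           Qₘ (Mʷ (reverse (a ∷ u))) (Mʷ (b ∷ y)) < Pₘ (Mʷ (reverse (a ∷ u))) (Mʷ (b ∷ y))
  ab-pos s rewrite Mʷ-reverse-∷ u a | Pₘ-ab (Mʷ (reverse u)) (Mʷ y) = m<m+n _ (ab-margin-pos u y s)
sign-sound (b ∷ u) (a ∷ y) = (λ ()) , ba-neg
  where
  ba-neg : sign (b ∷ u) (a ∷ y) ≡ neg →
           Pₘ (Mʷ (reverse (b ∷ u))) (Mʷ (a ∷ y)) < Qₘ (Mʷ (reverse (b ∷ u))) (Mʷ (a ∷ y))
  ba-neg _ rewrite Mʷ-reverse-∷ u b | Qₘ-ba (Mʷ (reverse u)) (Mʷ y) = m<m+n _ (ba-margin-pos (reverse u) y)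

sign-sound-at : ∀ x y → let X = Mʷ x; Y = Mʷ y in
  (sign (reverse x) y ≡ pos → Qₘ X Y < Pₘ X Y) × (sign (reverse x) y ≡ neg → Pₘ X Y < Qₘ X Y)
sign-sound-at x y = subst (λ z → SignSound′ z) (reverse-involutive x) (sign-sound (reverse x) y)
  where
  SignSound′ : Word → Set
  SignSound′ z = (sign (reverse x) y ≡ pos → Qₘ (Mʷ z) (Mʷ y) < Pₘ (Mʷ z) (Mʷ y)) ×
                 (sign (reverse x) y ≡ neg → Pₘ (Mʷ z) (Mʷ y) < Qₘ (Mʷ z) (Mʷ y))

swap-ab-improves : ∀ x y → sign (reverse x) y ≡ pos → mval (x ++ b ∷ a ∷ y) < mval (x ++ a ∷ b ∷ y)
swap-ab-improves x y s = +-trade-< (swap-identity x y) (*-monoʳ-< 2 (proj₁ (sign-sound-at x y) s))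

swap-ba-improves : ∀ x y → sign (reverse x) y ≡ neg → mval (x ++ a ∷ b ∷ y) < mval (x ++ b ∷ a ∷ y)
swap-ba-improves x y s = +-trade-< (sym (swap-identity x y)) (*-monoʳ-< 2 (proj₂ (sign-sound-at x y) s))

-- Christoffel morphisms and local minimality

G : Word → Word
G [] = []
G (a ∷ w) = a ∷ G w
G (b ∷ w) = a ∷ b ∷ G w

D : Word → Word
D [] = []
D (a ∷ w) = a ∷ b ∷ D w
D (b ∷ w) = b ∷ D w

Gʳ : Word → Word
Gʳ [] = []
Gʳ (a ∷ w) = a ∷ Gʳ w
Gʳ (b ∷ w) = b ∷ a ∷ Gʳ w

Dʳ : Word → Word
Dʳ [] = []
Dʳ (a ∷ w) = b ∷ a ∷ Dʳ w
Dʳ (b ∷ w) = b ∷ Dʳ w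

G-++ : ∀ x y → G (x ++ y) ≡ G x ++ G y
G-++ [] y = refl
G-++ (a ∷ x) y = cong (a ∷_) (G-++ x y)
G-++ (b ∷ x) y = cong (λ z → a ∷ b ∷ z) (G-++ x y)

D-++ : ∀ x y → D (x ++ y) ≡ D x ++ D y
D-++ [] y = refl
D-++ (a ∷ x) y = cong (λ z → a ∷ b ∷ z) (D-++ x y)
D-++ (b ∷ x) y = cong (b ∷_) (D-++ x y)

Gʳ-++ : ∀ x y → Gʳ (x ++ y) ≡ Gʳ x ++ Gʳ y
Gʳ-++ [] y = refl
Gʳ-++ (a ∷ x) y = cong (a ∷_) (Gʳ-++ x y)
Gʳ-++ (b ∷ x) y = cong (λ z → b ∷ a ∷ z) (Gʳ-++ x y)

Dʳ-++ : ∀ x y → Dʳ (x ++ y) ≡ Dʳ x ++ Dʳ y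
Dʳ-++ [] y = refl
Dʳ-++ (a ∷ x) y = cong (λ z → b ∷ a ∷ z) (Dʳ-++ x y)
Dʳ-++ (b ∷ x) y = cong (b ∷_) (Dʳ-++ x y)

reverse-G : ∀ x → reverse (G x) ≡ Gʳ (reverse x)
reverse-G [] = refl
reverse-G (a ∷ x) = begin
    reverse (a ∷ G x) ≡⟨ unfold-reverse a (G x) ⟩
    reverse (G x) ++ [ a ] ≡⟨ cong (_++ [ a ]) (reverse-G x) ⟩
    Gʳ (reverse x) ++ Gʳ [ a ] ≡⟨ sym (Gʳ-++ (reverse x) [ a ]) ⟩
    Gʳ (reverse x ++ [ a ]) ≡⟨ cong Gʳ (sym (unfold-reverse a x)) ⟩
    Gʳ (reverse (a ∷ x)) ∎
  where open ≡-Reasoning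
reverse-G (b ∷ x) = begin
    reverse (a ∷ b ∷ G x) ≡⟨ unfold-reverse a (b ∷ G x) ⟩
    reverse (b ∷ G x) ++ [ a ] ≡⟨ cong (_++ [ a ]) (unfold-reverse b (G x)) ⟩
    (reverse (G x) ++ [ b ]) ++ [ a ] ≡⟨ ++-assoc (reverse (G x)) [ b ] [ a ] ⟩
    reverse (G x) ++ Gʳ [ b ] ≡⟨ cong (_++ Gʳ [ b ]) (reverse-G x) ⟩
    Gʳ (reverse x) ++ Gʳ [ b ] ≡⟨ sym (Gʳ-++ (reverse x) [ b ]) ⟩
    Gʳ (reverse x ++ [ b ]) ≡⟨ cong Gʳ (sym (unfold-reverse b x)) ⟩
    Gʳ (reverse (b ∷ x)) ∎
  where open ≡-Reasoning

reverse-D : ∀ x → reverse (D x) ≡ Dʳ (reverse x)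
reverse-D [] = refl
reverse-D (b ∷ x) = begin
    reverse (b ∷ D x) ≡⟨ unfold-reverse b (D x) ⟩
    reverse (D x) ++ [ b ] ≡⟨ cong (_++ [ b ]) (reverse-D x) ⟩
    Dʳ (reverse x) ++ Dʳ [ b ] ≡⟨ sym (Dʳ-++ (reverse x) [ b ]) ⟩
    Dʳ (reverse x ++ [ b ]) ≡⟨ cong Dʳ (sym (unfold-reverse b x)) ⟩
    Dʳ (reverse (b ∷ x)) ∎
  where open ≡-Reasoning
reverse-D (a ∷ x) = begin
    reverse (a ∷ b ∷ D x) ≡⟨ unfold-reverse a (b ∷ D x) ⟩
    reverse (b ∷ D x) ++ [ a ] ≡⟨ cong (_++ [ a ]) (unfold-reverse b (D x)) ⟩
    (reverse (D x) ++ [ b ]) ++ [ a ] ≡⟨ ++-assoc (reverse (D x)) [ b ] [ a ] ⟩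
    reverse (D x) ++ Dʳ [ a ] ≡⟨ cong (_++ Dʳ [ a ]) (reverse-D x) ⟩
    Dʳ (reverse x) ++ Dʳ [ a ] ≡⟨ sym (Dʳ-++ (reverse x) [ a ]) ⟩
    Dʳ (reverse x ++ [ a ]) ≡⟨ cong Dʳ (sym (unfold-reverse a x)) ⟩
    Dʳ (reverse (a ∷ x)) ∎
  where open ≡-Reasoning

NonErasing : (Word → Word) → Set
NonErasing f = ∀ v → f v ≡ [] ⇔ v ≡ []

G-nonErasing : NonErasing G
G-nonErasing []      = mk⇔ (λ _ → refl) (λ _ → refl)
G-nonErasing (a ∷ v) = mk⇔ (λ ()) (λ ())
G-nonErasing (b ∷ v) = mk⇔ (λ ()) (λ ())

Gʳ-nonErasing : NonErasing Gʳ
Gʳ-nonErasing []      = mk⇔ (λ _ → refl) (λ _ → refl)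
Gʳ-nonErasing (a ∷ v) = mk⇔ (λ ()) (λ ())
Gʳ-nonErasing (b ∷ v) = mk⇔ (λ ()) (λ ())

D-nonErasing : NonErasing D
D-nonErasing []      = mk⇔ (λ _ → refl) (λ _ → refl)
D-nonErasing (a ∷ v) = mk⇔ (λ ()) (λ ())
D-nonErasing (b ∷ v) = mk⇔ (λ ()) (λ ())

Dʳ-nonErasing : NonErasing Dʳ
Dʳ-nonErasing []      = mk⇔ (λ _ → refl) (λ _ → refl)
Dʳ-nonErasing (a ∷ v) = mk⇔ (λ ()) (λ ())
Dʳ-nonErasing (b ∷ v) = mk⇔ (λ ()) (λ ())

signᵃᵇ-cong : ∀ {u v u′ v′} → u′ ≡ [] ⇔ u ≡ [] → v′ ≡ [] ⇔ v ≡ [] →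
              signᵃᵇ u′ v′ ≡ signᵃᵇ u v
signᵃᵇ-cong {[]}    {[]}    {[]}    {[]}    _ _ = refl
signᵃᵇ-cong {[]}    {_ ∷ _} {[]}    {_ ∷ _} _ _ = refl
signᵃᵇ-cong {_ ∷ _} {_}     {_ ∷ _} {_}     _ _ = refl
signᵃᵇ-cong {[]}    {_}     {_ ∷ _} {_}     eu _ with () ← Equivalence.from eu refl
signᵃᵇ-cong {_ ∷ _} {_}     {[]}    {_}     eu _ with () ← Equivalence.to eu refl
signᵃᵇ-cong {[]}    {[]}    {[]}    {_ ∷ _} _ ev with () ← Equivalence.from ev refl
signᵃᵇ-cong {[]}    {_ ∷ _} {[]}    {[]}    _ ev with () ← Equivalence.to ev refl

sign-G : ∀ u v → sign (a ∷ Gʳ u) (G v) ≡ sign u v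
sign-G [] [] = refl
sign-G [] (a ∷ v) = refl
sign-G [] (b ∷ v) = refl
sign-G (l ∷ u) [] = refl
sign-G (a ∷ u) (a ∷ v) = sign-G u v
sign-G (b ∷ u) (b ∷ v) = sign-G u v
sign-G (a ∷ u) (b ∷ v) = signᵃᵇ-cong (Gʳ-nonErasing u) (G-nonErasing v)
sign-G (b ∷ u) (a ∷ []) = refl
sign-G (b ∷ u) (a ∷ a ∷ v) = refl
sign-G (b ∷ u) (a ∷ b ∷ v) = refl

sign-D : ∀ u v → sign (Dʳ u) (b ∷ D v) ≡ sign u v
sign-D [] v = refl
sign-D (a ∷ u) [] = refl
sign-D (b ∷ u) [] with Dʳ u
... | [] = refl
... | _ ∷ _ = refl
sign-D (a ∷ u) (a ∷ v) = sign-D u v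
sign-D (b ∷ u) (b ∷ v) = sign-D u v
sign-D (a ∷ u) (b ∷ v) = signᵃᵇ-cong (Dʳ-nonErasing u) (D-nonErasing v)
sign-D (b ∷ []) (a ∷ v) = refl
sign-D (b ∷ a ∷ u) (a ∷ v) = refl
sign-D (b ∷ b ∷ u) (a ∷ v) = refl

reverse-∷ʳ : ∀ (xs : Word) l → reverse (xs ++ [ l ]) ≡ l ∷ reverse xs
reverse-∷ʳ xs l = reverse-++ xs [ l ]

record LocallyMinimal (w : Word) : Set where
  field
    ab-stable : ∀ x y → w ≡ x ++ a ∷ b ∷ y → sign (reverse x) y ≢ pos
    ba-stable : ∀ x y → w ≡ x ++ b ∷ a ∷ y → sign (reverse x) y ≢ neg
open LocallyMinimal public

G-site : ∀ {w} x l₁ l₂ y → G (l₁ ∷ l₂ ∷ y) ≡ a ∷ l₁ ∷ l₂ ∷ G y →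
         w ≡ x ++ l₁ ∷ l₂ ∷ y → G w ≡ (G x ++ [ a ]) ++ l₁ ∷ l₂ ∷ G y
G-site x l₁ l₂ y eq refl = trans (G-++ x _) (trans (cong (G x ++_) eq) (sym (++-assoc (G x) [ a ] _)))

sign-G-context : ∀ x y → sign (reverse (G x ++ [ a ])) (G y) ≡ sign (reverse x) y
sign-G-context x y =
  trans (cong (λ z → sign z (G y)) (trans (reverse-∷ʳ (G x) a) (cong (a ∷_) (reverse-G x)))) (sign-G (reverse x) y)

G-reflects-LM : ∀ w → LocallyMinimal (G w) → LocallyMinimal w
G-reflects-LM w L = record
  { ab-stable = λ x y e → ab-stable L _ _ (G-site x a b y refl e) ∘ trans (sign-G-context x y)
  ; ba-stable = λ x y e → ba-stable L _ _ (G-site x b a y refl e) ∘ trans (sign-G-context x y)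
  }

D-site : ∀ {w} x l₁ l₂ y → D (l₁ ∷ l₂ ∷ y) ≡ l₁ ∷ l₂ ∷ b ∷ D y →
         w ≡ x ++ l₁ ∷ l₂ ∷ y → D w ≡ D x ++ l₁ ∷ l₂ ∷ b ∷ D y
D-site x l₁ l₂ y eq refl = trans (D-++ x _) (cong (D x ++_) eq)

sign-D-context : ∀ x y → sign (reverse (D x)) (b ∷ D y) ≡ sign (reverse x) y
sign-D-context x y = trans (cong (λ z → sign z (b ∷ D y)) (reverse-D x)) (sign-D (reverse x) y)

D-reflects-LM : ∀ w → LocallyMinimal (D w) → LocallyMinimal w
D-reflects-LM w L = record
  { ab-stable = λ x y e → ab-stable L _ _ (D-site x a b y refl e) ∘ trans (sign-D-context x y)
  ; ba-stable = λ x y e → ba-stable L _ _ (D-site x b a y refl e) ∘ trans (sign-D-context x y)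
  }

opp : Letter → Letter
opp a = b
opp b = a

complement : Word → Word
complement [] = []
complement (l ∷ w) = opp l ∷ complement w

complement-++ : ∀ x y → complement (x ++ y) ≡ complement x ++ complement y
complement-++ [] y = refl
complement-++ (l ∷ x) y = cong (opp l ∷_) (complement-++ x y)

opp-involutive : ∀ l → opp (opp l) ≡ l
opp-involutive a = refl
opp-involutive b = refl

complement-involutive : ∀ x → complement (complement x) ≡ x
complement-involutive [] = refl
complement-involutive (l ∷ x) = cong₂ _∷_ (opp-involutive l) (complement-involutive x)

reverse-complement : ∀ x → reverse (complement x) ≡ complement (reverse x)
reverse-complement [] = refl
reverse-complement (l ∷ x) = begin
    reverse (opp l ∷ complement x) ≡⟨ unfold-reverse (opp l) (complement x) ⟩
    reverse (complement x) ++ [ opp l ] ≡⟨ cong (_++ [ opp l ]) (reverse-complement x) ⟩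
    complement (reverse x) ++ complement [ l ] ≡⟨ sym (complement-++ (reverse x) [ l ]) ⟩
    complement (reverse x ++ [ l ]) ≡⟨ cong complement (sym (unfold-reverse l x)) ⟩
    complement (reverse (l ∷ x)) ∎
  where open ≡-Reasoning

mirror : Word → Word
mirror w = complement (reverse w)

mirror-++ : ∀ x y → mirror (x ++ y) ≡ mirror y ++ mirror x
mirror-++ x y = trans (cong complement (reverse-++ x y)) (complement-++ (reverse y) (reverse x))

mirror-involutive : ∀ x → mirror (mirror x) ≡ x
mirror-involutive x = begin
    complement (reverse (complement (reverse x))) ≡⟨ cong complement (reverse-complement (reverse x)) ⟩
    complement (complement (reverse (reverse x))) ≡⟨ complement-involutive _ ⟩
    reverse (reverse x) ≡⟨ reverse-involutive x ⟩
    x ∎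
  where open ≡-Reasoning

signᵃᵇ-complement : ∀ u v → signᵃᵇ u v ≡ signᵃᵇ (complement v) (complement u)
signᵃᵇ-complement [] [] = refl
signᵃᵇ-complement [] (_ ∷ _) = refl
signᵃᵇ-complement (_ ∷ _) [] = refl
signᵃᵇ-complement (_ ∷ _) (_ ∷ _) = refl

sign-complement : ∀ u v → sign u v ≡ sign (complement v) (complement u)
sign-complement [] [] = refl
sign-complement [] (a ∷ v) = refl
sign-complement [] (b ∷ v) = refl
sign-complement (l ∷ u) [] = refl
sign-complement (a ∷ u) (a ∷ v) = sign-complement u v
sign-complement (b ∷ u) (b ∷ v) = sign-complement u v
sign-complement (a ∷ u) (b ∷ v) = signᵃᵇ-complement u v
sign-complement (b ∷ u) (a ∷ v) = refl

mirror-site : ∀ {w} x l₁ l₂ y → mirror (l₁ ∷ l₂ ∷ []) ≡ l₁ ∷ l₂ ∷ [] →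
              mirror w ≡ x ++ l₁ ∷ l₂ ∷ y → w ≡ mirror y ++ l₁ ∷ l₂ ∷ mirror x
mirror-site {w} x l₁ l₂ y eq e = begin
  w                                      ≡⟨ mirror-involutive w ⟨
  mirror (mirror w)                      ≡⟨ cong mirror e ⟩
  mirror (x ++ l₁ ∷ l₂ ∷ y)              ≡⟨ mirror-++ x (l₁ ∷ l₂ ∷ y) ⟩
  mirror ((l₁ ∷ l₂ ∷ []) ++ y) ++ mirror x ≡⟨ cong (_++ mirror x) (mirror-++ (l₁ ∷ l₂ ∷ []) y) ⟩
  (mirror y ++ mirror (l₁ ∷ l₂ ∷ [])) ++ mirror x ≡⟨ cong (λ m → (mirror y ++ m) ++ mirror x) eq ⟩
  (mirror y ++ l₁ ∷ l₂ ∷ []) ++ mirror x ≡⟨ ++-assoc (mirror y) (l₁ ∷ l₂ ∷ []) (mirror x) ⟩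
  mirror y ++ l₁ ∷ l₂ ∷ mirror x         ∎
  where open ≡-Reasoning

sign-mirror : ∀ x y → sign (reverse (mirror y)) (mirror x) ≡ sign (reverse x) y
sign-mirror x y = begin
  sign (reverse (complement (reverse y))) (complement (reverse x))
   
     ≡⟨ cong (λ z → sign z (complement (reverse x)))
             (trans (reverse-complement (reverse y)) (cong complement (reverse-involutive y))) ⟩
  sign (complement y) (complement (reverse x))
    ≡⟨ sign-complement (reverse x) y ⟨
  sign (reverse x) y ∎
  where open ≡-Reasoning

mirror-preserves-LM : ∀ w → LocallyMinimal w → LocallyMinimal (mirror w)
mirror-preserves-LM w L = record
  { ab-stable = λ x y e → ab-stable L _ _ (mirror-site x a b y refl e) ∘ trans (sign-mirror x y)
  ; ba-stable = λ x y e → ba-stable L _ _ (mirror-site x b a y refl e) ∘ trans (sign-mirror x y)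
  }

-- Locally minimal words with both aa and bb

data HasDouble (l : Letter) : Word → Set where
  here : ∀ w → HasDouble l (l ∷ l ∷ w)
  there : ∀ m w → HasDouble l w → HasDouble l (m ∷ w)

_≟ˡ_ : (x y : Letter) → Dec (x ≡ y)
a ≟ˡ a = yes refl
a ≟ˡ b = no (λ ())
b ≟ˡ a = no (λ ())
b ≟ˡ b = yes refl

startsDouble? : ∀ l m w → Dec (∃ λ w′ → m ∷ w ≡ l ∷ l ∷ w′)
startsDouble? l m [] = no λ { (_ , ()) }
startsDouble? l m (m′ ∷ w) with l ≟ˡ m | l ≟ˡ m′
... | yes refl | yes refl = yes (w , refl)
... | no ne | _ = no λ { (_ , refl) → ne refl }
... | yes _ | no ne = no λ { (_ , refl) → ne refl }

hasDouble? : ∀ l w → Dec (HasDouble l w)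
hasDouble? l [] = no (λ ())
hasDouble? l (m ∷ w) with startsDouble? l m w | hasDouble? l w
... | yes (w′ , refl) | _ = yes (here w′)
... | no _ | yes h = yes (there m w h)
... | no nh1 | no nh2 = no λ { (here w′) → nh1 (w′ , refl) ; (there _ _ h) → nh2 h }

G-preimage : ∀ w → ¬ HasDouble b w → (∀ w′ → w ≢ b ∷ w′) → ∃ λ w0 → w ≡ G w0
G-preimage [] _ _ = [] , refl
G-preimage (b ∷ w) _ nb = ⊥-elim (nb w refl)
G-preimage (a ∷ []) _ _ = a ∷ [] , refl
G-preimage (a ∷ a ∷ w) nh _ with G-preimage (a ∷ w) (λ h → nh (there a _ h)) (λ w′ ())
... | w0 , e = a ∷ w0 , cong (a ∷_) e
G-preimage (a ∷ b ∷ []) _ _ = b ∷ [] , refl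
G-preimage (a ∷ b ∷ b ∷ w) nh _ = ⊥-elim (nh (there a _ (here w)))
G-preimage (a ∷ b ∷ a ∷ w) nh _ with G-preimage (a ∷ w) (λ h → nh (there a _ (there b _ h))) (λ w′ ())
... | w0 , e = b ∷ w0 , cong (λ z → a ∷ b ∷ z) e

D-preimage : ∀ w → ¬ HasDouble a w → (∀ r → w ≢ r ++ [ a ]) → ∃ λ w0 → w ≡ D w0
D-preimage [] _ _ = [] , refl
D-preimage (b ∷ w) nh ne with D-preimage w (λ h → nh (there b _ h)) (λ r e → ne (b ∷ r) (cong (b ∷_) e))
... | w0 , e = b ∷ w0 , cong (b ∷_) e
D-preimage (a ∷ []) _ ne = ⊥-elim (ne [] refl)
D-preimage (a ∷ a ∷ w) nh _ = ⊥-elim (nh (here w))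
D-preimage (a ∷ b ∷ w) nh ne
  with D-preimage w (λ h → nh (there a _ (there b _ h))) (λ r e → ne (a ∷ b ∷ r) (cong (λ z → a ∷ b ∷ z) e))
... | w0 , e = a ∷ w0 , cong (λ z → a ∷ b ∷ z) e

sign-bⁿ : ∀ k y → sign (replicate k b) y ≡ neg
sign-bⁿ zero y = refl
sign-bⁿ (suc k) [] = refl
sign-bⁿ (suc k) (a ∷ y) = refl
sign-bⁿ (suc k) (b ∷ y) = sign-bⁿ k y

reverse-replicate : ∀ k (l : Letter) → reverse (replicate k l) ≡ replicate k l
reverse-replicate zero l = refl
reverse-replicate (suc k) l = trans (unfold-reverse l (replicate k l)) (trans (cong (_++ [ l ]) (reverse-replicate k l)) (comm k))
  where
  comm : ∀ k → replicate k l ++ [ l ] ≡ l ∷ replicate k l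
  comm zero = refl
  comm (suc k) = cong (l ∷_) (comm k)

bⁿba-prefix : ∀ w′ → 1 ≤ #a (b ∷ w′) → ∃₂ λ k r → b ∷ w′ ≡ replicate k b ++ b ∷ a ∷ r
bⁿba-prefix [] ()
bⁿba-prefix (a ∷ w′) _ = 0 , w′ , refl
bⁿba-prefix (b ∷ w′) h with bⁿba-prefix w′ h
... | k , r , e = suc k , r , cong (b ∷_) e

starts-with-a : ∀ w → LocallyMinimal w → 1 ≤ #a w → ∀ w′ → w ≢ b ∷ w′
starts-with-a w L h w′ e with bⁿba-prefix w′ (subst (λ z → 1 ≤ #a z) e h)
... | k , r , e2 =
  ba-stable L (replicate k b) r (trans e e2) (trans (cong (λ z → sign z r) (reverse-replicate k b)) (sign-bⁿ k r))

#a-++ : ∀ x y → #a (x ++ y) ≡ #a x + #a y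
#a-++ [] y = refl
#a-++ (a ∷ x) y = cong suc (#a-++ x y)
#a-++ (b ∷ x) y = #a-++ x y

#b-++ : ∀ x y → #b (x ++ y) ≡ #b x + #b y
#b-++ [] y = refl
#b-++ (a ∷ x) y = #b-++ x y
#b-++ (b ∷ x) y = cong suc (#b-++ x y)

#a-complement : ∀ x → #a (complement x) ≡ #b x
#a-complement [] = refl
#a-complement (a ∷ x) = #a-complement x
#a-complement (b ∷ x) = cong suc (#a-complement x)

#b-reverse : ∀ x → #b (reverse x) ≡ #b x
#b-reverse [] = refl
#b-reverse (l ∷ x) = trans (cong #b (unfold-reverse l x))
  (trans (#b-++ (reverse x) [ l ]) (trans (cong (_+ #b [ l ]) (#b-reverse x)) (#b-∷ʳ l)))
  where
  #b-∷ʳ : ∀ l → #b x + #b [ l ] ≡ #b (l ∷ x)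
  #b-∷ʳ a = +-identityʳ (#b x)
  #b-∷ʳ b = +-comm (#b x) 1

#a-mirror : ∀ x → #a (mirror x) ≡ #b x
#a-mirror x = trans (#a-complement (reverse x)) (#b-reverse x)

ends-with-b : ∀ w → LocallyMinimal w → 1 ≤ #b w → ∀ r → w ≢ r ++ [ a ]
ends-with-b w L h r e = starts-with-a (mirror w) (mirror-preserves-LM w L) (subst (1 ≤_) (sym (#a-mirror w)) h)
                                       (mirror r) (trans (cong mirror e) (mirror-++ r [ a ]))

ab^ ba^ : ℕ → Word
ab^ k = (a ∷ b ∷ []) ^ʷ k
ba^ k = (b ∷ a ∷ []) ^ʷ k

ba^-suc : ∀ k → ba^ (suc k) ≡ ba^ k ++ b ∷ a ∷ []
ba^-suc zero = refl
ba^-suc (suc k) = cong (λ z → b ∷ a ∷ z) (ba^-suc k)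

reverse-ab^ : ∀ k → reverse (ab^ k) ≡ ba^ k
reverse-ab^ zero = refl
reverse-ab^ (suc k) = begin
    reverse (a ∷ b ∷ ab^ k) ≡⟨ reverse-++ (a ∷ b ∷ []) (ab^ k) ⟩
    reverse (ab^ k) ++ b ∷ a ∷ [] ≡⟨ cong (_++ b ∷ a ∷ []) (reverse-ab^ k) ⟩
    ba^ k ++ b ∷ a ∷ [] ≡⟨ sym (ba^-suc k) ⟩
    ba^ (suc k) ∎
  where open ≡-Reasoning

reverse-ba^ : ∀ k → reverse (ba^ k) ≡ ab^ k
reverse-ba^ k = trans (cong reverse (sym (reverse-ab^ k))) (reverse-involutive (ab^ k))

mirror-ba^ : ∀ k → mirror (ba^ k) ≡ ba^ k
mirror-ba^ zero = refl
mirror-ba^ (suc k) = trans (mirror-++ (b ∷ a ∷ []) (ba^ k)) (trans (cong (_++ b ∷ a ∷ []) (mirror-ba^ k)) (sym (ba^-suc k)))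

sign≢neg⇒aa-prefix : ∀ m u y → sign u (ab^ m ++ a ∷ a ∷ y) ≢ neg →
                     ∃ λ i → i ≤ m × ∃ λ u′ → u ≡ ab^ i ++ a ∷ a ∷ u′
sign≢neg⇒aa-prefix zero [] y h = ⊥-elim (h refl)
sign≢neg⇒aa-prefix zero (b ∷ u) y h = ⊥-elim (h refl)
sign≢neg⇒aa-prefix zero (a ∷ []) y h = ⊥-elim (h refl)
sign≢neg⇒aa-prefix zero (a ∷ b ∷ u) y h = ⊥-elim (h refl)
sign≢neg⇒aa-prefix zero (a ∷ a ∷ u) y h = 0 , z≤n , u , refl
sign≢neg⇒aa-prefix (suc m) [] y h = ⊥-elim (h refl)
sign≢neg⇒aa-prefix (suc m) (b ∷ u) y h = ⊥-elim (h refl)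
sign≢neg⇒aa-prefix (suc m) (a ∷ []) y h = ⊥-elim (h refl)
sign≢neg⇒aa-prefix (suc m) (a ∷ a ∷ u) y h = 0 , z≤n , u , refl
sign≢neg⇒aa-prefix (suc m) (a ∷ b ∷ u) y h with sign≢neg⇒aa-prefix m u y h
... | i , i≤m , u′ , e = suc i , s≤s i≤m , u′ , cong (λ z → a ∷ b ∷ z) e

data AfterAlternation (m : ℕ) (y : Word) : Set where
  ends-ab^   : ∀ t → t ≤ suc m → y ≡ ab^ t → AfterAlternation m y
  ends-ab^a  : ∀ t → t ≤ m → y ≡ ab^ t ++ [ a ] → AfterAlternation m y
  meets-aa   : ∀ k → k ≤ m → ∀ y′ → y ≡ ab^ k ++ a ∷ a ∷ y′ → AfterAlternation m y

sign≢pos⇒alternation : ∀ m u y → sign (ab^ m ++ a ∷ a ∷ u) y ≢ pos → AfterAlternation m y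
sign≢pos⇒alternation zero u [] h = ends-ab^ 0 z≤n refl
sign≢pos⇒alternation zero u (b ∷ y) h = ⊥-elim (h refl)
sign≢pos⇒alternation zero u (a ∷ []) h = ends-ab^a 0 z≤n refl
sign≢pos⇒alternation zero u (a ∷ a ∷ y) h = meets-aa 0 z≤n y refl
sign≢pos⇒alternation zero [] (a ∷ b ∷ []) h = ends-ab^ 1 ≤-refl refl
sign≢pos⇒alternation zero [] (a ∷ b ∷ _ ∷ _) h = ⊥-elim (h refl)
sign≢pos⇒alternation zero (_ ∷ _) (a ∷ b ∷ _) h = ⊥-elim (h refl)
sign≢pos⇒alternation (suc m) u [] h = ends-ab^ 0 z≤n refl
sign≢pos⇒alternation (suc m) u (b ∷ y) h = ⊥-elim (h refl)
sign≢pos⇒alternation (suc m) u (a ∷ []) h = ends-ab^a 0 z≤n refl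
sign≢pos⇒alternation (suc m) u (a ∷ a ∷ y) h = meets-aa 0 z≤n y refl
sign≢pos⇒alternation (suc m) u (a ∷ b ∷ y) h with sign≢pos⇒alternation m u y h
... | ends-ab^ t t≤ e = ends-ab^ (suc t) (s≤s t≤) (cong (λ z → a ∷ b ∷ z) e)
... | ends-ab^a t t≤ e = ends-ab^a (suc t) (s≤s t≤) (cong (λ z → a ∷ b ∷ z) e)
... | meets-aa k k≤ y′ e = meets-aa (suc k) (s≤s k≤) y′ (cong (λ z → a ∷ b ∷ z) e)

sign-aa-ab^ : ∀ t m u → t ≤ m → sign (ab^ m ++ a ∷ a ∷ u) (ab^ t) ≡ neg
sign-aa-ab^ zero zero u _ = refl
sign-aa-ab^ zero (suc m) u _ = refl
sign-aa-ab^ (suc t) (suc m) u (s≤s le) = sign-aa-ab^ t m u le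

sign-[] : ∀ u → sign u [] ≡ neg
sign-[] [] = refl
sign-[] (_ ∷ _) = refl

reverse-aa-ba^ : ∀ x i → reverse (x ++ a ∷ a ∷ ba^ i) ≡ ab^ i ++ a ∷ a ∷ reverse x
reverse-aa-ba^ x i = begin
    reverse (x ++ a ∷ a ∷ ba^ i) ≡⟨ reverse-++ x (a ∷ a ∷ ba^ i) ⟩
    reverse ((a ∷ a ∷ []) ++ ba^ i) ++ reverse x ≡⟨ cong (_++ reverse x) (reverse-++ (a ∷ a ∷ []) (ba^ i)) ⟩
    (reverse (ba^ i) ++ a ∷ a ∷ []) ++ reverse x ≡⟨ ++-assoc (reverse (ba^ i)) (a ∷ a ∷ []) (reverse x) ⟩
    reverse (ba^ i) ++ a ∷ a ∷ reverse x ≡⟨ cong (_++ a ∷ a ∷ reverse x) (reverse-ba^ i) ⟩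
    ab^ i ++ a ∷ a ∷ reverse x ∎
  where open ≡-Reasoning

reverse-aa-ba^-b : ∀ x i → reverse ((x ++ a ∷ a ∷ ba^ i) ++ [ b ]) ≡ b ∷ ab^ i ++ a ∷ a ∷ reverse x
reverse-aa-ba^-b x i = trans (reverse-∷ʳ (x ++ a ∷ a ∷ ba^ i) b) (cong (b ∷_) (reverse-aa-ba^ x i))

bb-ab^-aa-context : ∀ w → LocallyMinimal w → ∀ x j y → w ≡ x ++ b ∷ b ∷ ab^ j ++ a ∷ a ∷ y →
                    ∃ λ i → i < j × ∃ λ x′ → x ≡ x′ ++ a ∷ a ∷ ba^ i
bb-ab^-aa-context w L x zero y e =
  ⊥-elim (ba-stable L (x ++ [ b ]) (a ∷ y) (trans e (sym (++-assoc x [ b ] (b ∷ a ∷ a ∷ y))))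
                    (cong (λ z → sign z (a ∷ y)) (reverse-∷ʳ x b)))
bb-ab^-aa-context w L x (suc j) y e with sign≢neg⇒aa-prefix j (reverse x) y ba-stable-at-bb
  where
  ba-stable-at-bb : sign (reverse x) (ab^ j ++ a ∷ a ∷ y) ≢ neg
  ba-stable-at-bb s = ba-stable L (x ++ [ b ]) (b ∷ ab^ j ++ a ∷ a ∷ y) (trans e (sym (++-assoc x [ b ] _)))
                        (trans (cong (λ z → sign z (b ∷ ab^ j ++ a ∷ a ∷ y)) (reverse-∷ʳ x b)) s)
... | i , i≤j , u′ , e2 = i , s≤s i≤j , reverse u′ , (begin
    x ≡⟨ sym (reverse-involutive x) ⟩
    reverse (reverse x) ≡⟨ cong reverse e2 ⟩
    reverse (ab^ i ++ a ∷ a ∷ u′) ≡⟨ reverse-++ (ab^ i) (a ∷ a ∷ u′) ⟩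
    reverse ((a ∷ a ∷ []) ++ u′) ++ reverse (ab^ i)
      ≡⟨ cong₂ _++_ (reverse-++ (a ∷ a ∷ []) u′) (reverse-ab^ i) ⟩
    (reverse u′ ++ a ∷ a ∷ []) ++ ba^ i ≡⟨ ++-assoc (reverse u′) (a ∷ a ∷ []) (ba^ i) ⟩
    reverse u′ ++ a ∷ a ∷ ba^ i ∎)
  where open ≡-Reasoning

¬ends-ba : ∀ w → LocallyMinimal w → ∀ r → w ≢ r ++ b ∷ a ∷ []
¬ends-ba w L r e = ba-stable L r [] e (sign-[] (reverse r))

¬ends-b-ab^-a : ∀ w → LocallyMinimal w → ∀ t r → w ≢ r ++ b ∷ (ab^ t ++ [ a ])
¬ends-b-ab^-a w L zero r e = ¬ends-ba w L r e
¬ends-b-ab^-a w L (suc t) r e = ¬ends-b-ab^-a w L t (r ++ b ∷ [ a ]) (trans e (sym (++-assoc r (b ∷ [ a ]) _)))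

aa-ba^-b-split : ∀ x i y → x ++ a ∷ a ∷ ba^ i ++ b ∷ y ≡ ((x ++ a ∷ a ∷ ba^ i) ++ [ b ]) ++ y
aa-ba^-b-split x i y = sym (trans (++-assoc (x ++ a ∷ a ∷ ba^ i) [ b ] y) (++-assoc x (a ∷ a ∷ ba^ i) (b ∷ y)))

signᵃᵇ-nonempty : ∀ u l y → signᵃᵇ u (l ∷ y) ≡ pos
signᵃᵇ-nonempty []      l y = refl
signᵃᵇ-nonempty (_ ∷ _) l y = refl

aa-ba^-bb-context : ∀ w → LocallyMinimal w → ∀ x i y → w ≡ x ++ a ∷ a ∷ ba^ i ++ b ∷ b ∷ y →
                    y ≡ [] ⊎ ∃ λ k → k < i × ∃ λ y′ → y ≡ ab^ k ++ a ∷ a ∷ y′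
aa-ba^-bb-context w L x zero [] e = inj₁ refl
aa-ba^-bb-context w L x zero (l ∷ y) e =
  ⊥-elim (ab-stable L (x ++ [ a ]) (b ∷ l ∷ y) (trans e (sym (++-assoc x [ a ] _)))
           (trans (cong (λ z → sign z (b ∷ l ∷ y)) (reverse-∷ʳ x a)) (signᵃᵇ-nonempty (reverse x) l y)))
aa-ba^-bb-context w L x (suc i) y e with sign≢pos⇒alternation i (reverse x) y ab-stable-at-last-ba
  where
  ab-stable-at-last-ba : sign (ab^ i ++ a ∷ a ∷ reverse x) y ≢ pos
  ab-stable-at-last-ba s = ab-stable L ((x ++ a ∷ a ∷ ba^ i) ++ [ b ]) (b ∷ y)
    (trans e (trans (cong (λ q → x ++ a ∷ a ∷ q) (trans (cong (_++ b ∷ b ∷ y) (ba^-suc i)) (++-assoc (ba^ i) _ _)))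
                    (aa-ba^-b-split x i _)))
    (trans (cong (λ z → sign z (b ∷ y)) (reverse-aa-ba^-b x i)) s)
... | ends-ab^ zero _ refl = inj₁ refl
... | ends-ab^ (suc t) (s≤s t≤i) refl =
  ⊥-elim (ba-stable L ((x ++ a ∷ a ∷ ba^ (suc i)) ++ [ b ]) (b ∷ ab^ t) (trans e (aa-ba^-b-split x (suc i) _))
    (trans (cong (λ z → sign z (b ∷ ab^ t)) (reverse-aa-ba^-b x (suc i)))
           (sign-aa-ab^ t (suc i) (reverse x) (≤-trans t≤i (n≤1+n i)))))
... | ends-ab^a t _ refl = ⊥-elim (¬ends-b-ab^-a w L t _ (trans e (aa-ba^-b-split x (suc i) _)))
... | meets-aa k k≤i y′ refl = inj₂ (k , s≤s k≤i , y′ , refl)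

ab^-aa-injective : ∀ k j y y′ → k < j → ab^ j ++ a ∷ a ∷ y ≢ ab^ k ++ a ∷ a ∷ y′
ab^-aa-injective zero (suc j) y y′ _ ()
ab^-aa-injective (suc k) (suc j) y y′ (s≤s lt) e = ab^-aa-injective k j y y′ lt (∷-injectiveʳ (∷-injectiveʳ e))

-- bb (ab)ʲ aa forces an aa (ba)ⁱ bb before it with i < j, which in turn forces the (ab)ʲ aa after
-- it to be (ab)ᵏ aa with k < i.
¬bb-ab^-aa : ∀ w → LocallyMinimal w → ∀ x j y → w ≢ x ++ b ∷ b ∷ ab^ j ++ a ∷ a ∷ y
¬bb-ab^-aa w L x j y e with bb-ab^-aa-context w L x j y e
... | i , i<j , x′ , ex with aa-ba^-bb-context w L x′ i (ab^ j ++ a ∷ a ∷ y) e′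
  where
  e′ : w ≡ x′ ++ a ∷ a ∷ ba^ i ++ b ∷ b ∷ ab^ j ++ a ∷ a ∷ y
  e′ = trans e (trans (cong (_++ b ∷ b ∷ ab^ j ++ a ∷ a ∷ y) ex) (++-assoc x′ (a ∷ a ∷ ba^ i) _))
... | inj₁ e0 = lem j e0
  where
  lem : ∀ j → ab^ j ++ a ∷ a ∷ y ≢ []
  lem zero ()
  lem (suc j) ()
... | inj₂ (k , k<i , y′ , ey) = ab^-aa-injective k j y y′ (<-trans k<i i<j) ey

aa-ba^-bb-suffix : ∀ w → LocallyMinimal w → ∀ x i y → w ≡ x ++ a ∷ a ∷ ba^ i ++ b ∷ b ∷ y → y ≡ []
aa-ba^-bb-suffix w L x i y e with aa-ba^-bb-context w L x i y e
... | inj₁ e0 = e0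
... | inj₂ (k , k<i , y′ , refl) =
  ⊥-elim (¬bb-ab^-aa w L (x ++ a ∷ a ∷ ba^ i) k y′ (trans e (sym (++-assoc x (a ∷ a ∷ ba^ i) _))))

first-bb : ∀ r → ¬ HasDouble a (a ∷ r) → HasDouble b (a ∷ r) →
           ∃₂ λ i r′ → a ∷ r ≡ a ∷ ba^ i ++ b ∷ b ∷ r′
first-bb [] _ (there _ _ ())
first-bb (a ∷ r) na _ = ⊥-elim (na (here r))
first-bb (b ∷ []) _ (there _ _ (there _ _ ()))
first-bb (b ∷ b ∷ r) _ _ = 0 , r , refl
first-bb (b ∷ a ∷ r) na (there _ _ (there _ _ hb)) with first-bb r (λ h → na (there a _ (there b _ h))) hb
... | i , r′ , e = suc i , r′ , cong (λ z → a ∷ b ∷ z) e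

first-aa : ∀ r → ¬ HasDouble b (b ∷ r) → HasDouble a (b ∷ r) →
           ∃₂ λ i r′ → b ∷ r ≡ b ∷ ab^ i ++ a ∷ a ∷ r′
first-aa [] _ (there _ _ ())
first-aa (b ∷ r) nb _ = ⊥-elim (nb (here r))
first-aa (a ∷ []) _ (there _ _ (there _ _ ()))
first-aa (a ∷ a ∷ r) _ _ = 0 , r , refl
first-aa (a ∷ b ∷ r) nb (there _ _ (there _ _ ha)) with first-aa r (λ h → nb (there b _ (there a _ h))) ha
... | i , r′ , e = suc i , r′ , cong (λ z → b ∷ a ∷ z) e

data DoubleFactor (w : Word) : Set where
  bb-ab^-aa : ∀ x j y → w ≡ x ++ b ∷ b ∷ ab^ j ++ a ∷ a ∷ y → DoubleFactor w
  aa-ba^-bb : ∀ x j y → w ≡ x ++ a ∷ a ∷ ba^ j ++ b ∷ b ∷ y → DoubleFactor w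

DoubleFactor-∷ : ∀ l w → DoubleFactor w → DoubleFactor (l ∷ w)
DoubleFactor-∷ l w (bb-ab^-aa x j y e) = bb-ab^-aa (l ∷ x) j y (cong (l ∷_) e)
DoubleFactor-∷ l w (aa-ba^-bb x j y e) = aa-ba^-bb (l ∷ x) j y (cong (l ∷_) e)

-- Skip every double letter that recurs further right; from the last aa (resp. bb) the word
-- alternates up to the next bb (resp. aa).
mutual
  find-double-factor : ∀ w → HasDouble a w → HasDouble b w → DoubleFactor w
  find-double-factor (a ∷ a ∷ r) (here .r) (there .a .(a ∷ r) hb) =
    skip-aa (a ∷ r) hb (hasDouble? a (a ∷ r)) λ no-aa →
      let i , r′ , e = first-bb r no-aa hb in aa-ba^-bb [] i r′ (cong (a ∷_) e)
  find-double-factor (b ∷ b ∷ r) (there .b .(b ∷ r) ha) (here .r) =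
    skip-bb (b ∷ r) ha (hasDouble? b (b ∷ r)) λ no-bb →
      let i , r′ , e = first-aa r no-bb ha in bb-ab^-aa [] i r′ (cong (b ∷_) e)
  find-double-factor (l ∷ w) (there .l .w ha) (there .l .w hb) = DoubleFactor-∷ l w (find-double-factor w ha hb)

  skip-aa : ∀ {l} w → HasDouble b w → Dec (HasDouble a w) → (¬ HasDouble a w → DoubleFactor (l ∷ w)) →
            DoubleFactor (l ∷ w)
  skip-aa w hb (yes ha) _    = DoubleFactor-∷ _ w (find-double-factor w ha hb)
  skip-aa w hb (no no-aa) k = k no-aa

  skip-bb : ∀ {l} w → HasDouble a w → Dec (HasDouble b w) → (¬ HasDouble b w → DoubleFactor (l ∷ w)) →
            DoubleFactor (l ∷ w)
  skip-bb w ha (yes hb) _    = DoubleFactor-∷ _ w (find-double-factor w ha hb)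
  skip-bb w ha (no no-bb) k = k no-bb

mirror-nil : ∀ x → mirror x ≡ [] → x ≡ []
mirror-nil x e = trans (sym (mirror-involutive x)) (cong mirror e)

mirror-aa-ba^-bb : ∀ i → mirror (a ∷ a ∷ ba^ i ++ b ∷ b ∷ []) ≡ a ∷ a ∷ ba^ i ++ b ∷ b ∷ []
mirror-aa-ba^-bb i = trans (mirror-++ (a ∷ a ∷ []) (ba^ i ++ b ∷ b ∷ []))
  (cong (_++ b ∷ b ∷ []) (trans (mirror-++ (ba^ i) (b ∷ b ∷ [])) (cong (λ q → a ∷ a ∷ q) (mirror-ba^ i))))

aa-and-bb⇒aa-ba^-bb : ∀ w → LocallyMinimal w → HasDouble a w → HasDouble b w →
                      ∃ λ i → w ≡ a ∷ a ∷ ba^ i ++ b ∷ b ∷ []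
aa-and-bb⇒aa-ba^-bb w L ha hb with find-double-factor w ha hb
... | bb-ab^-aa x j y e = ⊥-elim (¬bb-ab^-aa w L x j y e)
... | aa-ba^-bb x i y e with refl ← aa-ba^-bb-suffix w L x i y e =
  i , trans e (cong (_++ a ∷ a ∷ ba^ i ++ b ∷ b ∷ []) (mirror-nil x no-prefix))
  where
  mirrored : mirror w ≡ a ∷ a ∷ ba^ i ++ b ∷ b ∷ mirror x
  mirrored = trans (cong mirror e) (trans (mirror-++ x _)
               (trans (cong (_++ mirror x) (mirror-aa-ba^-bb i)) (++-assoc (a ∷ a ∷ ba^ i) (b ∷ b ∷ []) (mirror x))))
  no-prefix : mirror x ≡ []
  no-prefix = aa-ba^-bb-suffix (mirror w) (mirror-preserves-LM w L) [] i (mirror x) mirrored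

-- Christoffel paths and the Stern–Brocot tree

inits-any⁻ : ∀ {P : Word → Set} c → Any P (inits c) → ∃₂ λ q r → c ≡ q ++ r × P q
inits-any⁻ [] (here p) = [] , [] , refl , p
inits-any⁻ (l ∷ c) (here p) = [] , l ∷ c , refl , p
inits-any⁻ {P} (l ∷ c) (there p) with inits-any⁻ {P ∘ (l ∷_)} c (map⁻ p)
... | q , r , e , pq = l ∷ q , r , cong (l ∷_) e , pq

inits-any⁺ : ∀ {P : Word → Set} c q r → c ≡ q ++ r → P q → Any P (inits c)
inits-any⁺ [] [] r e p = here p
inits-any⁺ (l ∷ c) [] r e p = here p
inits-any⁺ [] (l ∷ q) r () p
inits-any⁺ {P} (l ∷ c) (m ∷ q) r e p with ∷-injective e
... | refl , e′ = there (map⁺ (inits-any⁺ {P ∘ (l ∷_)} c q r e′ p))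

++-prefix-compare : ∀ (q q′ s s′ : Word) → q ++ s ≡ q′ ++ s′ →
                    (∃ λ t → q ≡ q′ ++ t) ⊎ (∃ λ t → q′ ≡ q ++ t)
++-prefix-compare [] q′ s s′ e = inj₂ (q′ , refl)
++-prefix-compare (l ∷ q) [] s s′ e = inj₁ (l ∷ q , refl)
++-prefix-compare (l ∷ q) (m ∷ q′) s s′ e with ∷-injective e
... | refl , e′ with ++-prefix-compare q q′ s s′ e′
...   | inj₁ (t , e2) = inj₁ (t , cong (l ∷_) e2)
...   | inj₂ (t , e2) = inj₂ (t , cong (l ∷_) e2)

¬OnPath-above-a : ∀ c q r → c ≡ q ++ a ∷ r → ¬ OnPath c (#a q) (suc (#b q))
¬OnPath-above-a c q r e op with inits-any⁻ c op
... | q′ , r′ , e′ , ea , eb with ++-prefix-compare q q′ (a ∷ r) r′ (trans (sym e) e′)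
...   | inj₁ (t , refl) = m≢1+m+n (#b q′) (trans eb (cong suc (#b-++ q′ t)))
...   | inj₂ ([] , refl) =
  m≢1+m+n (#b q) {0} (trans (sym (cong #b (++-identityʳ q))) (trans eb (cong suc (sym (+-identityʳ (#b q))))))
...   | inj₂ (l ∷ t , refl)
  with ∷-injectiveˡ (++-cancelˡ q (a ∷ r) (l ∷ t ++ r′) (trans (trans (sym e) e′) (++-assoc q (l ∷ t) r′)))
...     | refl = m≢1+m+n (#a q) (trans (sym ea) (trans (#a-++ q (a ∷ t)) (+-suc (#a q) (#a t))))

-- From (x , y), take k steps, going up exactly when (x , y + 1) stays weakly below the line
-- through the origin of slope n / d: the lower Christoffel path.
greedyFrom : ℕ → ℕ → ℕ → ℕ → ℕ → Word
greedyFrom d n x y zero = []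
greedyFrom d n x y (suc k) with suc y * d ≤? x * n
... | yes _ = b ∷ greedyFrom d n x (suc y) k
... | no _ = a ∷ greedyFrom d n (suc x) y k

greedy : ℕ → ℕ → Word
greedy d n = greedyFrom d n 0 0 (d + n)

length-#a+#b : ∀ w → length w ≡ #a w + #b w
length-#a+#b [] = refl
length-#a+#b (a ∷ w) = cong suc (length-#a+#b w)
length-#a+#b (b ∷ w) = trans (cong suc (length-#a+#b w)) (sym (+-suc (#a w) (#b w)))

#a-∷ʳa : ∀ q → #a (q ++ [ a ]) ≡ suc (#a q)
#a-∷ʳa q = trans (#a-++ q [ a ]) (+-comm (#a q) 1)

#a-∷ʳb : ∀ q → #a (q ++ [ b ]) ≡ #a q
#a-∷ʳb q = trans (#a-++ q [ b ]) (+-identityʳ (#a q))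

#b-∷ʳa : ∀ q → #b (q ++ [ a ]) ≡ #b q
#b-∷ʳa q = trans (#b-++ q [ a ]) (+-identityʳ (#b q))

#b-∷ʳb : ∀ q → #b (q ++ [ b ]) ≡ suc (#b q)
#b-∷ʳb q = trans (#b-++ q [ b ]) (+-comm (#b q) 1)

y<n : ∀ d n x y → x < d → suc y * d ≤ x * n → suc y ≤ n
y<n zero n x y () le
y<n (suc d′) n x y x<d le =
  *-cancelʳ-≤ (suc y) n (suc d′) (≤-trans le (≤-trans (*-monoˡ-≤ n (<⇒≤ x<d)) (≤-reflexive (*-comm (suc d′) n))))

IsC⇒greedyFrom : ∀ d n c → IsC d n c → ∀ q r → c ≡ q ++ r → r ≡ greedyFrom d n (#a q) (#b q) (length r)
IsC⇒greedyFrom d n c I q [] e = refl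
IsC⇒greedyFrom d n c I q (l ∷ r) e with suc (#b q) * d ≤? #a q * n
IsC⇒greedyFrom d n c I q (a ∷ r) e | yes le =
  ⊥-elim (¬OnPath-above-a c q r e (IsC.empty I (#a q) (suc (#b q)) (#b q) x≤d y≤n le op (n≤1+n _)))
  where
  op : OnPath c (#a q) (#b q)
  op = inits-any⁺ c q (a ∷ r) e (refl , refl)
  dA : #a c ≡ #a q + suc (#a r)
  dA = trans (cong #a e) (#a-++ q (a ∷ r))
  x<d : #a q < d
  x<d = subst (#a q <_) (trans (sym dA) (proj₁ (IsC.ends I))) (m<m+n (#a q) (s≤s z≤n))
  x≤d : #a q ≤ d
  x≤d = <⇒≤ x<d
  y≤n : suc (#b q) ≤ n
  y≤n = y<n d n (#a q) (#b q) x<d le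
IsC⇒greedyFrom d n c I q (b ∷ r) e | yes le = cong (b ∷_)
  (subst₂ (λ u v → r ≡ greedyFrom d n u v (length r)) (#a-∷ʳb q) (#b-∷ʳb q)
          (IsC⇒greedyFrom d n c I (q ++ [ b ]) r (trans e (sym (++-assoc q [ b ] r)))))
IsC⇒greedyFrom d n c I q (a ∷ r) e | no nle = cong (a ∷_)
  (subst₂ (λ u v → r ≡ greedyFrom d n u v (length r)) (#a-∷ʳa q) (#b-∷ʳa q)
          (IsC⇒greedyFrom d n c I (q ++ [ a ]) r (trans e (sym (++-assoc q [ a ] r)))))
IsC⇒greedyFrom d n c I q (b ∷ r) e | no nle = ⊥-elim (nle (subst₂ (λ u v → v * d ≤ u * n) (#a-∷ʳb q) (#b-∷ʳb q)
  (IsC.below I (#a (q ++ [ b ])) (#b (q ++ [ b ]))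
               (inits-any⁺ c (q ++ [ b ]) r (trans e (sym (++-assoc q [ b ] r))) (refl , refl)))))

IsC⇒greedy : ∀ d n c → IsC d n c → c ≡ greedy d n
IsC⇒greedy d n c I = trans (IsC⇒greedyFrom d n c I [] c refl)
  (cong (greedyFrom d n 0 0) (trans (length-#a+#b c) (cong₂ _+_ (proj₁ (IsC.ends I)) (proj₂ (IsC.ends I)))))

greedyFrom-b : ∀ d n x y k → suc y * d ≤ x * n → greedyFrom d n x y (suc k) ≡ b ∷ greedyFrom d n x (suc y) k
greedyFrom-b d n x y k le with suc y * d ≤? x * n
... | yes _ = refl
... | no nle = ⊥-elim (nle le)

greedyFrom-a : ∀ d n x y k → ¬ (suc y * d ≤ x * n) → greedyFrom d n x y (suc k) ≡ a ∷ greedyFrom d n (suc x) y k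
greedyFrom-a d n x y k nle with suc y * d ≤? x * n
... | yes le = ⊥-elim (nle le)
... | no _ = refl

G-greedyFrom : ∀ d n x y k → x * n < suc y * d + n →
               G (greedyFrom d n x y k) ≡ greedyFrom (d + n) n (x + y) y (k + #b (greedyFrom d n x y k))
G-greedyFrom d n x y zero inv = refl
G-greedyFrom d n x y (suc k) inv with suc y * d ≤? x * n
... | yes le = begin
    a ∷ b ∷ G rest ≡⟨ cong (λ z → a ∷ b ∷ z) (G-greedyFrom d n x (suc y) k inv′) ⟩
    a ∷ b ∷ greedyFrom (d + n) n (x + suc y) (suc y) (k + #b rest)
      ≡⟨ cong (λ z → a ∷ b ∷ greedyFrom (d + n) n z (suc y) (k + #b rest)) (+-suc x y) ⟩
    a ∷ b ∷ greedyFrom (d + n) n (suc (x + y)) (suc y) (k + #b rest)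
      ≡⟨ cong (a ∷_) (sym (greedyFrom-b (d + n) n (suc (x + y)) y _ c2)) ⟩
    a ∷ greedyFrom (d + n) n (suc (x + y)) y (suc (k + #b rest))
      ≡⟨ sym (greedyFrom-a (d + n) n (x + y) y _ c1) ⟩
    greedyFrom (d + n) n (x + y) y (suc (suc (k + #b rest)))
      ≡⟨ cong (greedyFrom (d + n) n (x + y) y) (cong suc (sym (+-suc k (#b rest)))) ⟩
    greedyFrom (d + n) n (x + y) y (suc k + suc (#b rest)) ∎
  where
  open ≡-Reasoning
  rest = greedyFrom d n x (suc y) k
  e1 : ∀ d n y → suc y * (d + n) ≡ (suc y * d + n) + y * n
  e1 = solve-∀
  e2 : ∀ x y n → (x + y) * n ≡ x * n + y * n
  e2 = solve-∀
  e3 : ∀ x y n → suc (x + y) * n ≡ x * n + suc y * n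
  e3 = solve-∀
  e4 : ∀ d n y → suc y * (d + n) ≡ suc y * d + suc y * n
  e4 = solve-∀
  inv′ : x * n < suc (suc y) * d + n
  inv′ = <-≤-trans inv (+-monoˡ-≤ n (*-monoˡ-≤ d (n≤1+n (suc y))))
  c1 : ¬ (suc y * (d + n) ≤ (x + y) * n)
  c1 h = <⇒≱ inv (+-cancelʳ-≤ (y * n) _ _ (subst₂ _≤_ (e1 d n y) (e2 x y n) h))
  c2 : suc y * (d + n) ≤ suc (x + y) * n
  c2 = subst₂ _≤_ (sym (e4 d n y)) (sym (e3 x y n)) (+-monoˡ-≤ (suc y * n) le)
... | no nle = begin
    a ∷ G rest ≡⟨ cong (a ∷_) (G-greedyFrom d n (suc x) y k inv′) ⟩
    a ∷ greedyFrom (d + n) n (suc x + y) y (k + #b rest) ≡⟨ sym (greedyFrom-a (d + n) n (x + y) y _ c1) ⟩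
    greedyFrom (d + n) n (x + y) y (suc k + #b rest) ∎
  where
  open ≡-Reasoning
  rest = greedyFrom d n (suc x) y k
  e1 : ∀ d n y → suc y * (d + n) ≡ (suc y * d + n) + y * n
  e1 = solve-∀
  e2 : ∀ x y n → (x + y) * n ≡ x * n + y * n
  e2 = solve-∀
  lt : x * n < suc y * d
  lt = ≰⇒> nle
  inv′ : suc x * n < suc y * d + n
  inv′ = subst (_< suc y * d + n) (+-comm (x * n) n) (+-monoˡ-< n lt)
  c1 : ¬ (suc y * (d + n) ≤ (x + y) * n)
  c1 h = <⇒≱ lt (≤-trans (m≤m+n (suc y * d) n) (+-cancelʳ-≤ (y * n) _ _ (subst₂ _≤_ (e1 d n y) (e2 x y n) h)))

D-greedyFrom : ∀ d n x y k → y * d ≤ x * n + n →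
               D (greedyFrom d n x y k) ≡ greedyFrom d (d + n) x (x + y) (k + #a (greedyFrom d n x y k))
D-greedyFrom d n x y zero inv = refl
D-greedyFrom d n x y (suc k) inv with suc y * d ≤? x * n
... | yes le = begin
    b ∷ D rest ≡⟨ cong (b ∷_) (D-greedyFrom d n x (suc y) k inv′) ⟩
    b ∷ greedyFrom d (d + n) x (x + suc y) (k + #a rest)
      ≡⟨ cong (λ z → b ∷ greedyFrom d (d + n) x z (k + #a rest)) (+-suc x y) ⟩
    b ∷ greedyFrom d (d + n) x (suc (x + y)) (k + #a rest) ≡⟨ sym (greedyFrom-b d (d + n) x (x + y) _ c1) ⟩
    greedyFrom d (d + n) x (x + y) (suc k + #a rest) ∎
  where
  open ≡-Reasoning
  rest = greedyFrom d n x (suc y) k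
  e1 : ∀ x y d → suc (x + y) * d ≡ x * d + suc y * d
  e1 = solve-∀
  e2 : ∀ x d n → x * (d + n) ≡ x * d + x * n
  e2 = solve-∀
  inv′ : suc y * d ≤ x * n + n
  inv′ = ≤-trans le (m≤m+n (x * n) n)
  c1 : suc (x + y) * d ≤ x * (d + n)
  c1 = subst₂ _≤_ (sym (e1 x y d)) (sym (e2 x d n)) (+-monoʳ-≤ (x * d) le)
... | no nle = begin
    a ∷ b ∷ D rest ≡⟨ cong (λ z → a ∷ b ∷ z) (D-greedyFrom d n (suc x) y k inv′) ⟩
    a ∷ b ∷ greedyFrom d (d + n) (suc x) (suc x + y) (k + #a rest)
      ≡⟨ cong (a ∷_) (sym (greedyFrom-b d (d + n) (suc x) (x + y) _ c2)) ⟩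
    a ∷ greedyFrom d (d + n) (suc x) (x + y) (suc (k + #a rest))
      ≡⟨ sym (greedyFrom-a d (d + n) x (x + y) _ c1) ⟩
    greedyFrom d (d + n) x (x + y) (suc (suc (k + #a rest)))
      ≡⟨ cong (greedyFrom d (d + n) x (x + y)) (cong suc (sym (+-suc k (#a rest)))) ⟩
    greedyFrom d (d + n) x (x + y) (suc k + suc (#a rest)) ∎
  where
  open ≡-Reasoning
  rest = greedyFrom d n (suc x) y k
  e1 : ∀ x y d → suc (x + y) * d ≡ x * d + suc y * d
  e1 = solve-∀
  e2 : ∀ x d n → x * (d + n) ≡ x * d + x * n
  e2 = solve-∀
  e3 : ∀ x y d → suc (x + y) * d ≡ (x * d + d) + y * d
  e3 = solve-∀
  e4 : ∀ x d n → suc x * (d + n) ≡ (x * d + d) + (x * n + n)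
  e4 = solve-∀
  inv′ : y * d ≤ suc x * n + n
  inv′ = ≤-trans inv (+-monoˡ-≤ n (subst (x * n ≤_) (+-comm (x * n) n) (m≤m+n (x * n) n)))
  c1 : ¬ (suc (x + y) * d ≤ x * (d + n))
  c1 h = nle (+-cancelˡ-≤ (x * d) _ _ (subst₂ _≤_ (e1 x y d) (e2 x d n) h))
  c2 : suc (x + y) * d ≤ suc x * (d + n)
  c2 = subst₂ _≤_ (sym (e3 x y d)) (sym (e4 x d n)) (+-monoʳ-≤ (x * d + d) inv)

apb : Word → Word
apb p = a ∷ p ++ [ b ]

-- SternBrocot u v p: a p b is the lower Christoffel word of slope v / u, obtained from ab by
-- the morphisms G and D.
data SternBrocot : ℕ → ℕ → Word → Set where
  root : SternBrocot 1 1 []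
  G-step : ∀ {u v p} → SternBrocot u v p → SternBrocot (u + v) v (G p ++ [ a ])
  D-step : ∀ {u v p} → SternBrocot u v p → SternBrocot u (u + v) (b ∷ D p)

G-apb : ∀ p → G (apb p) ≡ apb (G p ++ [ a ])
G-apb p = cong (a ∷_) (trans (G-++ p [ b ]) (sym (++-assoc (G p) [ a ] [ b ])))

D-apb : ∀ p → D (apb p) ≡ apb (b ∷ D p)
D-apb p = cong (λ z → a ∷ b ∷ z) (D-++ p [ b ])

#a-G : ∀ w → #a (G w) ≡ #a w + #b w
#a-G [] = refl
#a-G (a ∷ w) = cong suc (#a-G w)
#a-G (b ∷ w) = trans (cong suc (#a-G w)) (sym (+-suc (#a w) (#b w)))

#b-G : ∀ w → #b (G w) ≡ #b w
#b-G [] = refl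
#b-G (a ∷ w) = #b-G w
#b-G (b ∷ w) = cong suc (#b-G w)

#a-D : ∀ w → #a (D w) ≡ #a w
#a-D [] = refl
#a-D (a ∷ w) = cong suc (#a-D w)
#a-D (b ∷ w) = #a-D w

#b-D : ∀ w → #b (D w) ≡ #a w + #b w
#b-D [] = refl
#b-D (a ∷ w) = cong suc (#b-D w)
#b-D (b ∷ w) = trans (cong suc (#b-D w)) (sym (+-suc (#a w) (#b w)))

SB-counts : ∀ {u v p} → SternBrocot u v p → #a (apb p) ≡ u × #b (apb p) ≡ v
SB-counts root = refl , refl
SB-counts (G-step {u} {v} {p} e) with SB-counts e
... | ea , eb = trans (cong #a (sym (G-apb p))) (trans (#a-G (apb p)) (cong₂ _+_ ea eb)) ,
                trans (cong #b (sym (G-apb p))) (trans (#b-G (apb p)) eb)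
SB-counts (D-step {u} {v} {p} e) with SB-counts e
... | ea , eb = trans (cong #a (sym (D-apb p))) (trans (#a-D (apb p)) ea) ,
                trans (cong #b (sym (D-apb p))) (trans (#b-D (apb p)) (cong₂ _+_ ea eb))

SB-positive : ∀ {u v p} → SternBrocot u v p → 1 ≤ u × 1 ≤ v
SB-positive root = s≤s z≤n , s≤s z≤n
SB-positive (G-step e) with SB-positive e
... | pu , pv = ≤-trans pu (m≤m+n _ _) , pv
SB-positive (D-step e) with SB-positive e
... | pu , pv = pu , ≤-trans pu (m≤m+n _ _)

SB-coprime : ∀ {u v p} → SternBrocot u v p → Coprime u v
SB-coprime root = gcd≡1⇒coprime (gcd-zeroˡ 1)
SB-coprime (G-step {u} {v} e) = subst (λ z → Coprime z v) (+-comm v u) (coprime-+ (SB-coprime e))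
SB-coprime (D-step {u} {v} e) = Coprimality.sym (coprime-+ (Coprimality.sym (SB-coprime e)))

a∷Gʳ : ∀ p → a ∷ Gʳ p ≡ G p ++ [ a ]
a∷Gʳ [] = refl
a∷Gʳ (a ∷ p) = cong (a ∷_) (a∷Gʳ p)
a∷Gʳ (b ∷ p) = cong (λ z → a ∷ b ∷ z) (a∷Gʳ p)

Dʳ-∷ʳb : ∀ p → Dʳ p ++ [ b ] ≡ b ∷ D p
Dʳ-∷ʳb [] = refl
Dʳ-∷ʳb (a ∷ p) = cong (λ z → b ∷ a ∷ z) (Dʳ-∷ʳb p)
Dʳ-∷ʳb (b ∷ p) = cong (b ∷_) (Dʳ-∷ʳb p)

SB-palindrome : ∀ {u v p} → SternBrocot u v p → reverse p ≡ p
SB-palindrome root = refl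
SB-palindrome (G-step {p = p} e) =
  trans (reverse-∷ʳ (G p) a) (trans (cong (a ∷_) (trans (reverse-G p) (cong Gʳ (SB-palindrome e)))) (a∷Gʳ p))
SB-palindrome (D-step {p = p} e) =
  trans (unfold-reverse b (D p)) (trans (cong (_++ [ b ]) (trans (reverse-D p) (cong Dʳ (SB-palindrome e)))) (Dʳ-∷ʳb p))

G-^ʷ : ∀ w k → G (w ^ʷ k) ≡ G w ^ʷ k
G-^ʷ w zero = refl
G-^ʷ w (suc k) = trans (G-++ w (w ^ʷ k)) (cong (G w ++_) (G-^ʷ w k))

D-^ʷ : ∀ w k → D (w ^ʷ k) ≡ D w ^ʷ k
D-^ʷ w zero = refl
D-^ʷ w (suc k) = trans (D-++ w (w ^ʷ k)) (cong (D w ++_) (D-^ʷ w k))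

#a-^ʷ : ∀ w k → #a (w ^ʷ k) ≡ k * #a w
#a-^ʷ w zero = refl
#a-^ʷ w (suc k) = trans (#a-++ w (w ^ʷ k)) (cong (#a w +_) (#a-^ʷ w k))

#b-^ʷ : ∀ w k → #b (w ^ʷ k) ≡ k * #b w
#b-^ʷ w zero = refl
#b-^ʷ w (suc k) = trans (#b-++ w (w ^ʷ k)) (cong (#b w +_) (#b-^ʷ w k))

greedyFrom-diagonal : ∀ δ → 1 ≤ δ → ∀ x t → greedyFrom δ δ x x (t + t) ≡ (a ∷ b ∷ []) ^ʷ t
greedyFrom-diagonal δ pδ x zero = refl
greedyFrom-diagonal δ pδ x (suc t) = begin
    greedyFrom δ δ x x (suc t + suc t) ≡⟨ cong (greedyFrom δ δ x x) (cong suc (+-suc t t)) ⟩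
    greedyFrom δ δ x x (suc (suc (t + t))) ≡⟨ greedyFrom-a δ δ x x _ c1 ⟩
    a ∷ greedyFrom δ δ (suc x) x (suc (t + t)) ≡⟨ cong (a ∷_) (greedyFrom-b δ δ (suc x) x _ ≤-refl) ⟩
    a ∷ b ∷ greedyFrom δ δ (suc x) (suc x) (t + t)
      ≡⟨ cong (λ z → a ∷ b ∷ z) (greedyFrom-diagonal δ pδ (suc x) t) ⟩
    a ∷ b ∷ (a ∷ b ∷ []) ^ʷ t ∎
  where
  open ≡-Reasoning
  c1 : ¬ (suc x * δ ≤ x * δ)
  c1 h = <⇒≱ (subst (x * δ <_) (+-comm (x * δ) δ) (m<m+n (x * δ) pδ)) h

greedy-diagonal : ∀ δ → greedy δ δ ≡ (a ∷ b ∷ []) ^ʷ δ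
greedy-diagonal zero = refl
greedy-diagonal (suc δ) = greedyFrom-diagonal (suc δ) (s≤s z≤n) 0 (suc δ)

greedy-SB : ∀ {u v p} → SternBrocot u v p → ∀ δ → greedy (u * δ) (v * δ) ≡ apb p ^ʷ δ
greedy-SB root δ = trans (cong₂ greedy (*-identityˡ δ) (*-identityˡ δ)) (greedy-diagonal δ)
greedy-SB (G-step {u} {v} {p} e) zero rewrite *-zeroʳ (u + v) | *-zeroʳ v = refl
greedy-SB (G-step {u} {v} {p} e) (suc δ′) = begin
    greedy ((u + v) * δ) (v * δ) ≡⟨ cong (λ z → greedy z (v * δ)) (*-distribʳ-+ δ u v) ⟩
    greedyFrom (U + V) V 0 0 ((U + V) + V) ≡⟨ cong (λ z → greedyFrom (U + V) V 0 0 ((U + V) + z)) (sym cntB) ⟩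
    greedyFrom (U + V) V 0 0 ((U + V) + #b (greedy U V)) ≡⟨ sym (G-greedyFrom U V 0 0 (U + V) inv) ⟩
    G (greedy U V) ≡⟨ cong G (greedy-SB e δ) ⟩
    G (apb p ^ʷ δ) ≡⟨ G-^ʷ (apb p) δ ⟩
    G (apb p) ^ʷ δ ≡⟨ cong (_^ʷ δ) (G-apb p) ⟩
    apb (G p ++ [ a ]) ^ʷ δ ∎
  where
  open ≡-Reasoning
  δ = suc δ′
  U = u * δ
  V = v * δ
  cntB : #b (greedy U V) ≡ V
  cntB = trans (cong #b (greedy-SB e δ))
           (trans (#b-^ʷ (apb p) δ) (trans (cong (δ *_) (proj₂ (SB-counts e))) (*-comm δ v)))
  inv : 0 * V < 1 * U + V
  inv = ≤-trans (*-mono-≤ (proj₁ (SB-positive e)) (s≤s z≤n))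
                (≤-trans (≤-reflexive (sym (*-identityˡ U))) (m≤m+n (1 * U) V))
greedy-SB (D-step {u} {v} {p} e) zero rewrite *-zeroʳ u | *-zeroʳ (u + v) = refl
greedy-SB (D-step {u} {v} {p} e) (suc δ′) = begin
    greedy (u * δ) ((u + v) * δ) ≡⟨ cong (greedy (u * δ)) (*-distribʳ-+ δ u v) ⟩
    greedyFrom U (U + V) 0 0 (U + (U + V))
      ≡⟨ cong (greedyFrom U (U + V) 0 0) (trans (+-comm U (U + V)) (cong ((U + V) +_) (sym cntA))) ⟩
    greedyFrom U (U + V) 0 0 ((U + V) + #a (greedy U V)) ≡⟨ sym (D-greedyFrom U V 0 0 (U + V) z≤n) ⟩
    D (greedy U V) ≡⟨ cong D (greedy-SB e δ) ⟩
    D (apb p ^ʷ δ) ≡⟨ D-^ʷ (apb p) δ ⟩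
    D (apb p) ^ʷ δ ≡⟨ cong (_^ʷ δ) (D-apb p) ⟩
    apb (b ∷ D p) ^ʷ δ ∎
  where
  open ≡-Reasoning
  δ = suc δ′
  U = u * δ
  V = v * δ
  cntA : #a (greedy U V) ≡ U
  cntA = trans (cong #a (greedy-SB e δ))
           (trans (#a-^ʷ (apb p) δ) (trans (cong (δ *_) (proj₁ (SB-counts e))) (*-comm δ u)))

-- The second minimiser

twin : Word → ℕ → Word
twin p j = (a ∷ p ++ [ a ]) ++ ((b ∷ p ++ [ a ]) ^ʷ j) ++ (b ∷ p ++ [ b ])

^ʷ-∷ʳ : ∀ (w : Word) m → w ^ʷ m ++ w ≡ w ++ w ^ʷ m
^ʷ-∷ʳ w zero = sym (++-identityʳ w)
^ʷ-∷ʳ w (suc m) = trans (++-assoc w (w ^ʷ m) w) (cong (w ++_) (^ʷ-∷ʳ w m))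

^ʷ-conjugate : ∀ (q u : Word) m → (q ++ u) ^ʷ m ++ q ≡ q ++ (u ++ q) ^ʷ m
^ʷ-conjugate q u zero = sym (++-identityʳ q)
^ʷ-conjugate q u (suc m) = begin
    ((q ++ u) ++ (q ++ u) ^ʷ m) ++ q ≡⟨ ++-assoc (q ++ u) _ q ⟩
    (q ++ u) ++ ((q ++ u) ^ʷ m ++ q) ≡⟨ cong ((q ++ u) ++_) (^ʷ-conjugate q u m) ⟩
    (q ++ u) ++ (q ++ (u ++ q) ^ʷ m) ≡⟨ ++-assoc q u _ ⟩
    q ++ (u ++ (q ++ (u ++ q) ^ʷ m)) ≡⟨ cong (q ++_) (sym (++-assoc u q _)) ⟩
    q ++ ((u ++ q) ++ (u ++ q) ^ʷ m) ∎
  where open ≡-Reasoning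

reverse-^ʷ : ∀ (w : Word) m → reverse (w ^ʷ m) ≡ reverse w ^ʷ m
reverse-^ʷ w zero = refl
reverse-^ʷ w (suc m) = trans (reverse-++ w (w ^ʷ m)) (trans (cong (_++ reverse w) (reverse-^ʷ w m)) (^ʷ-∷ʳ (reverse w) m))

apb^ʷ-suc : ∀ p k → apb p ^ʷ suc k ≡ a ∷ (p ++ (b ∷ a ∷ p) ^ʷ k) ++ [ b ]
apb^ʷ-suc p zero = cong (a ∷_) (trans (++-identityʳ (p ++ [ b ])) (cong (_++ [ b ]) (sym (++-identityʳ p))))
apb^ʷ-suc p (suc k) = begin
    apb p ++ apb p ^ʷ suc k ≡⟨ cong (apb p ++_) (apb^ʷ-suc p k) ⟩
    a ∷ (p ++ [ b ]) ++ a ∷ (p ++ Y ^ʷ k) ++ [ b ] ≡⟨ cong (a ∷_) (++-assoc p [ b ] _) ⟩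
    a ∷ p ++ b ∷ a ∷ (p ++ Y ^ʷ k) ++ [ b ] ≡⟨ cong (a ∷_) (sym (++-assoc p (Y ++ Y ^ʷ k) [ b ])) ⟩
    a ∷ (p ++ (Y ++ Y ^ʷ k)) ++ [ b ] ∎
  where
  open ≡-Reasoning
  Y = b ∷ a ∷ p

a∷twin-tail : ∀ p k → a ∷ ((b ∷ p ++ [ a ]) ^ʷ k ++ (b ∷ p ++ [ b ])) ≡ (a ∷ b ∷ p) ^ʷ suc k ++ [ b ]
a∷twin-tail p zero = cong (λ z → a ∷ b ∷ z) (cong (_++ [ b ]) (sym (++-identityʳ p)))
a∷twin-tail p (suc k) = begin
    a ∷ ((b ∷ p ++ [ a ]) ++ (b ∷ p ++ [ a ]) ^ʷ k) ++ (b ∷ p ++ [ b ])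
      ≡⟨ cong (a ∷_) (++-assoc (b ∷ p ++ [ a ]) _ _) ⟩
    a ∷ b ∷ (p ++ [ a ]) ++ ((b ∷ p ++ [ a ]) ^ʷ k ++ (b ∷ p ++ [ b ]))
      ≡⟨ cong (λ z → a ∷ b ∷ z) (++-assoc p [ a ] _) ⟩
    a ∷ b ∷ p ++ a ∷ ((b ∷ p ++ [ a ]) ^ʷ k ++ (b ∷ p ++ [ b ]))
      ≡⟨ cong (λ z → a ∷ b ∷ p ++ z) (a∷twin-tail p k) ⟩
    a ∷ b ∷ p ++ ((a ∷ b ∷ p) ^ʷ suc k ++ [ b ]) ≡⟨ sym (++-assoc (a ∷ b ∷ p) _ [ b ]) ⟩
    ((a ∷ b ∷ p) ++ (a ∷ b ∷ p) ^ʷ suc k) ++ [ b ] ∎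
  where open ≡-Reasoning

twin-unfold : ∀ p k → twin p k ≡ a ∷ (p ++ (a ∷ b ∷ p) ^ʷ suc k) ++ [ b ]
twin-unfold p k = begin
    (a ∷ p ++ [ a ]) ++ R ≡⟨ cong (a ∷_) (++-assoc p [ a ] R) ⟩
    a ∷ p ++ a ∷ R ≡⟨ cong (λ z → a ∷ p ++ z) (a∷twin-tail p k) ⟩
    a ∷ p ++ ((a ∷ b ∷ p) ^ʷ suc k ++ [ b ]) ≡⟨ cong (a ∷_) (sym (++-assoc p _ [ b ])) ⟩
    a ∷ (p ++ (a ∷ b ∷ p) ^ʷ suc k) ++ [ b ] ∎
  where
  open ≡-Reasoning
  R = (b ∷ p ++ [ a ]) ^ʷ k ++ (b ∷ p ++ [ b ])

entrySum : Mat → ℕ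
entrySum M = m11 M + m12 M + m21 M + m22 M

transpose : Mat → Mat
transpose (mat p q r s) = mat p r q s

mval-a∷∷ʳb : ∀ z → mval (a ∷ z ++ [ b ]) ≡ entrySum (Mʷ z)
mval-a∷∷ʳb z rewrite Mʷ-∷ʳ z b = go (Mʷ z)
  where
  go : ∀ Z → m12 (Aₘ ⊗ (Z ⊗ Bₘ)) ≡ entrySum Z
  go (mat z1 z2 z3 z4) = l z1 z2 z3 z4
    where
    l : ∀ z1 z2 z3 z4 → 1 * (z1 * 1 + z2 * 1) + 1 * (z3 * 1 + z4 * 1) ≡ z1 + z2 + z3 + z4
    l = solve-∀

transpose-⊗ : ∀ l Z → transpose Z ⊗ Mˡ l ≡ transpose (Mˡ l ⊗ Z)
transpose-⊗ a (mat z1 z2 z3 z4) = mat-cong (l1 z1 z3) (l2 z1 z3) (l1 z2 z4) (l2 z2 z4)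
  where
  l1 : ∀ x y → x * 1 + y * 1 ≡ 1 * x + 1 * y
  l1 = solve-∀
  l2 : ∀ x y → x * 1 + y * 2 ≡ 1 * x + 2 * y
  l2 = solve-∀
transpose-⊗ b (mat z1 z2 z3 z4) = mat-cong (l1 z1 z3) (l2 z1 z3) (l1 z2 z4) (l2 z2 z4)
  where
  l1 : ∀ x y → x * 2 + y * 1 ≡ 2 * x + 1 * y
  l1 = solve-∀
  l2 : ∀ x y → x * 1 + y * 1 ≡ 1 * x + 1 * y
  l2 = solve-∀

Mʷ-reverse : ∀ z → Mʷ (reverse z) ≡ transpose (Mʷ z)
Mʷ-reverse [] = refl
Mʷ-reverse (l ∷ z) = trans (Mʷ-reverse-∷ z l) (trans (cong (_⊗ Mˡ l) (Mʷ-reverse z)) (transpose-⊗ l (Mʷ z)))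

entrySum-transpose : ∀ M → entrySum (transpose M) ≡ entrySum M
entrySum-transpose (mat p q r s) = l p q r s
  where
  l : ∀ p q r s → p + r + q + s ≡ p + q + r + s
  l = solve-∀

-- m(a z b) is the entry sum of Mʷ z, which reversal (transposition) preserves; both words
-- have this shape, with reversed middles since p is a palindrome.
mval-twin : ∀ p k → reverse p ≡ p → mval (apb p ^ʷ suc (suc k)) ≡ mval (twin p k)
mval-twin p k pal = begin
    mval (apb p ^ʷ suc (suc k)) ≡⟨ cong mval (apb^ʷ-suc p (suc k)) ⟩
    mval (a ∷ zc ++ [ b ]) ≡⟨ mval-a∷∷ʳb zc ⟩
    entrySum (Mʷ zc) ≡⟨ sym (entrySum-transpose (Mʷ zc)) ⟩
    entrySum (transpose (Mʷ zc)) ≡⟨ cong entrySum (sym (Mʷ-reverse zc)) ⟩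
    entrySum (Mʷ (reverse zc)) ≡⟨ cong (λ z → entrySum (Mʷ z)) revz ⟩
    entrySum (Mʷ zc′) ≡⟨ sym (mval-a∷∷ʳb zc′) ⟩
    mval (a ∷ zc′ ++ [ b ]) ≡⟨ cong mval (sym (twin-unfold p k)) ⟩
    mval (twin p k) ∎
  where
  open ≡-Reasoning
  zc = p ++ (b ∷ a ∷ p) ^ʷ suc k
  zc′ = p ++ (a ∷ b ∷ p) ^ʷ suc k
  revY : reverse (b ∷ a ∷ p) ≡ p ++ a ∷ b ∷ []
  revY = trans (reverse-++ (b ∷ a ∷ []) p) (cong (_++ a ∷ b ∷ []) pal)
  revz : reverse zc ≡ zc′
  revz = begin
      reverse zc ≡⟨ reverse-++ p _ ⟩
      reverse ((b ∷ a ∷ p) ^ʷ suc k) ++ reverse p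
        ≡⟨ cong₂ _++_ (trans (reverse-^ʷ (b ∷ a ∷ p) (suc k)) (cong (_^ʷ suc k) revY)) pal ⟩
      (p ++ a ∷ b ∷ []) ^ʷ suc k ++ p ≡⟨ ^ʷ-conjugate p (a ∷ b ∷ []) (suc k) ⟩
      zc′ ∎

G-twin : ∀ p j → G (twin p j) ≡ twin (G p ++ [ a ]) j
G-twin p j = begin
    G (twin p j) ≡⟨ G-++ (a ∷ p ++ [ a ]) _ ⟩
    G (a ∷ p ++ [ a ]) ++ G ((b ∷ p ++ [ a ]) ^ʷ j ++ (b ∷ p ++ [ b ]))
      ≡⟨ cong₂ _++_ e1 (trans (G-++ ((b ∷ p ++ [ a ]) ^ʷ j) _) (cong₂ _++_ e2 e3)) ⟩
    (a ∷ G′ ++ [ a ]) ++ ((a ∷ U) ^ʷ j ++ (a ∷ T))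
      ≡⟨ cong ((a ∷ G′ ++ [ a ]) ++_) (sym (++-assoc ((a ∷ U) ^ʷ j) [ a ] T)) ⟩
    (a ∷ G′ ++ [ a ]) ++ (((a ∷ U) ^ʷ j ++ [ a ]) ++ T)
      ≡⟨ cong (λ z → (a ∷ G′ ++ [ a ]) ++ (z ++ T)) (^ʷ-conjugate [ a ] U j) ⟩
    (a ∷ G′ ++ [ a ]) ++ (a ∷ (U ++ [ a ]) ^ʷ j ++ T) ≡⟨ cong (a ∷_) (++-assoc (G′ ++ [ a ]) [ a ] _) ⟨
    (a ∷ (G′ ++ [ a ]) ++ [ a ]) ++ ((U ++ [ a ]) ^ʷ j ++ T)
      ≡⟨ cong (λ z → (a ∷ (G′ ++ [ a ]) ++ [ a ]) ++ ((U ++ [ a ]) ^ʷ j ++ b ∷ z)) (sym (++-assoc G′ [ a ] [ b ])) ⟩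
    twin (G p ++ [ a ]) j ∎
  where
  open ≡-Reasoning
  G′ = G p
  U = b ∷ G′ ++ [ a ]
  T = b ∷ G′ ++ a ∷ b ∷ []
  e1 : G (a ∷ p ++ [ a ]) ≡ a ∷ G′ ++ [ a ]
  e1 = cong (a ∷_) (G-++ p [ a ])
  e2 : G ((b ∷ p ++ [ a ]) ^ʷ j) ≡ (a ∷ U) ^ʷ j
  e2 = trans (G-^ʷ (b ∷ p ++ [ a ]) j) (cong (λ z → (a ∷ b ∷ z) ^ʷ j) (G-++ p [ a ]))
  e3 : G (b ∷ p ++ [ b ]) ≡ a ∷ T
  e3 = cong (λ z → a ∷ b ∷ z) (G-++ p [ b ])

D-twin : ∀ p j → D (twin p j) ≡ twin (b ∷ D p) j
D-twin p j = begin
    D (twin p j) ≡⟨ D-++ (a ∷ p ++ [ a ]) _ ⟩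
    D (a ∷ p ++ [ a ]) ++ D ((b ∷ p ++ [ a ]) ^ʷ j ++ (b ∷ p ++ [ b ]))
      ≡⟨ cong₂ _++_ e1 (trans (D-++ ((b ∷ p ++ [ a ]) ^ʷ j) _) (cong₂ _++_ e2 e3)) ⟩
    (a ∷ b ∷ D′ ++ a ∷ b ∷ []) ++ ((Z ++ [ b ]) ^ʷ j ++ (b ∷ D′ ++ [ b ]))
      ≡⟨ cong (λ z → a ∷ b ∷ z ++ ((Z ++ [ b ]) ^ʷ j ++ (b ∷ D′ ++ [ b ]))) (sym (++-assoc D′ [ a ] [ b ])) ⟩
    (a ∷ b ∷ (D′ ++ [ a ]) ++ [ b ]) ++ ((Z ++ [ b ]) ^ʷ j ++ (b ∷ D′ ++ [ b ]))
      ≡⟨ ++-assoc (a ∷ b ∷ D′ ++ [ a ]) [ b ] _ ⟩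
    (a ∷ b ∷ D′ ++ [ a ]) ++ (b ∷ ((Z ++ [ b ]) ^ʷ j ++ (b ∷ D′ ++ [ b ])))
      ≡⟨ cong ((a ∷ b ∷ D′ ++ [ a ]) ++_) (++-assoc [ b ] ((Z ++ [ b ]) ^ʷ j) _) ⟨
    (a ∷ b ∷ D′ ++ [ a ]) ++ (([ b ] ++ (Z ++ [ b ]) ^ʷ j) ++ (b ∷ D′ ++ [ b ]))
      ≡⟨ cong (λ z → (a ∷ b ∷ D′ ++ [ a ]) ++ (z ++ (b ∷ D′ ++ [ b ]))) (sym (^ʷ-conjugate [ b ] Z j)) ⟩
    (a ∷ b ∷ D′ ++ [ a ]) ++ ((([ b ] ++ Z) ^ʷ j ++ [ b ]) ++ (b ∷ D′ ++ [ b ]))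
      ≡⟨ cong ((a ∷ b ∷ D′ ++ [ a ]) ++_) (++-assoc (([ b ] ++ Z) ^ʷ j) [ b ] _) ⟩
    twin (b ∷ D p) j ∎
  where
  open ≡-Reasoning
  D′ = D p
  Z = b ∷ D′ ++ [ a ]
  e1 : D (a ∷ p ++ [ a ]) ≡ a ∷ b ∷ D′ ++ a ∷ b ∷ []
  e1 = cong (λ z → a ∷ b ∷ z) (D-++ p [ a ])
  e2 : D ((b ∷ p ++ [ a ]) ^ʷ j) ≡ (Z ++ [ b ]) ^ʷ j
  e2 = trans (D-^ʷ (b ∷ p ++ [ a ]) j) (cong (_^ʷ j) (cong (b ∷_) (trans (D-++ p [ a ]) (sym (++-assoc D′ [ a ] [ b ])))))
  e3 : D (b ∷ p ++ [ b ]) ≡ b ∷ D′ ++ [ b ]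
  e3 = cong (b ∷_) (D-++ p [ b ])

G-bⁿ : ∀ n → G (replicate n b) ≡ (a ∷ b ∷ []) ^ʷ n
G-bⁿ zero = refl
G-bⁿ (suc n) = cong (λ z → a ∷ b ∷ z) (G-bⁿ n)

D-aⁿ : ∀ n → D (replicate n a) ≡ (a ∷ b ∷ []) ^ʷ n
D-aⁿ zero = refl
D-aⁿ (suc n) = cong (λ z → a ∷ b ∷ z) (D-aⁿ n)

#a≡0⇒bⁿ : ∀ w → #a w ≡ 0 → w ≡ replicate (#b w) b
#a≡0⇒bⁿ [] _ = refl
#a≡0⇒bⁿ (a ∷ w) ()
#a≡0⇒bⁿ (b ∷ w) e = cong (b ∷_) (#a≡0⇒bⁿ w e)

#b≡0⇒aⁿ : ∀ w → #b w ≡ 0 → w ≡ replicate (#a w) a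
#b≡0⇒aⁿ [] _ = refl
#b≡0⇒aⁿ (b ∷ w) ()
#b≡0⇒aⁿ (a ∷ w) e = cong (a ∷_) (#b≡0⇒aⁿ w e)

#a≡0-unique : ∀ u w → #a u ≡ 0 → #a w ≡ 0 → #b u ≡ #b w → u ≡ w
#a≡0-unique u w ♯aᵤ ♯aᵥ eq =
  trans (#a≡0⇒bⁿ u ♯aᵤ) (trans (cong (λ k → replicate k b) eq) (sym (#a≡0⇒bⁿ w ♯aᵥ)))

#b≡0-unique : ∀ u w → #b u ≡ 0 → #b w ≡ 0 → #a u ≡ #a w → u ≡ w
#b≡0-unique u w ♯bᵤ ♯bᵥ eq =
  trans (#b≡0⇒aⁿ u ♯bᵤ) (trans (cong (λ k → replicate k a) eq) (sym (#b≡0⇒aⁿ w ♯bᵥ)))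

-- Classification and minimality

MinimalShape : Word → ℕ → Word → Set
MinimalShape p δ w = w ≡ apb p ^ʷ δ ⊎ (2 ≤ δ × w ≡ twin p (δ ∸ 2))

record MinimalForm (w : Word) : Set where
  constructor minimalForm
  field
    {u v δ} : ℕ
    {p}     : Word
    tree    : SternBrocot u v p
    #a≡     : #a w ≡ u * δ
    #b≡     : #b w ≡ v * δ
    shape   : MinimalShape p δ w

G-shape : ∀ {p δ w} → MinimalShape p δ w → MinimalShape (G p ++ [ a ]) δ (G w)
G-shape {p} {δ} (inj₁ refl)         = inj₁ (trans (G-^ʷ (apb p) δ) (cong (_^ʷ δ) (G-apb p)))
G-shape {p} {δ} (inj₂ (2≤δ , refl)) = inj₂ (2≤δ , G-twin p (δ ∸ 2))

D-shape : ∀ {p δ w} → MinimalShape p δ w → MinimalShape (b ∷ D p) δ (D w)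
D-shape {p} {δ} (inj₁ refl)         = inj₁ (trans (D-^ʷ (apb p) δ) (cong (_^ʷ δ) (D-apb p)))
D-shape {p} {δ} (inj₂ (2≤δ , refl)) = inj₂ (2≤δ , D-twin p (δ ∸ 2))

G-minimalForm : ∀ {w} → MinimalForm w → MinimalForm (G w)
G-minimalForm {w} (minimalForm {u} {v} {δ} t ♯a ♯b sh) = minimalForm (G-step t)
  (trans (#a-G w) (trans (cong₂ _+_ ♯a ♯b) (sym (*-distribʳ-+ δ u v)))) (trans (#b-G w) ♯b) (G-shape sh)

D-minimalForm : ∀ {w} → MinimalForm w → MinimalForm (D w)
D-minimalForm {w} (minimalForm {u} {v} {δ} t ♯a ♯b sh) = minimalForm (D-step t)
  (trans (#a-D w) ♯a) (trans (#b-D w) (trans (cong₂ _+_ ♯a ♯b) (sym (*-distribʳ-+ δ u v)))) (D-shape sh)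

G-bⁿ-minimalForm : ∀ w → #a w ≡ 0 → MinimalForm (G w)
G-bⁿ-minimalForm w ♯a = minimalForm root
  (trans (#a-G w) (trans (cong (_+ #b w) ♯a) (sym (*-identityˡ _)))) (trans (#b-G w) (sym (*-identityˡ _)))
  (inj₁ (trans (cong G (#a≡0⇒bⁿ w ♯a)) (G-bⁿ (#b w))))

D-aⁿ-minimalForm : ∀ w → #b w ≡ 0 → MinimalForm (D w)
D-aⁿ-minimalForm w ♯b = minimalForm root
  (trans (#a-D w) (sym (*-identityˡ _)))
  (trans (#b-D w) (trans (cong (#a w +_) ♯b) (trans (+-identityʳ _) (sym (*-identityˡ _)))))
  (inj₁ (trans (cong D (#b≡0⇒aⁿ w ♯b)) (D-aⁿ (#a w))))

#ab-ba^bb : ∀ i → #a (ba^ i ++ b ∷ b ∷ []) ≡ i × #b (ba^ i ++ b ∷ b ∷ []) ≡ suc (suc i)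
#ab-ba^bb zero    = refl , refl
#ab-ba^bb (suc i) = Data.Product.map (cong suc) (cong suc) (#ab-ba^bb i)

aa-ba^-bb-minimalForm : ∀ i → MinimalForm (a ∷ a ∷ ba^ i ++ b ∷ b ∷ [])
aa-ba^-bb-minimalForm i = minimalForm {δ = suc (suc i)} root
  (trans (cong (suc ∘ suc) (proj₁ (#ab-ba^bb i))) (sym (*-identityˡ _)))
  (trans (proj₂ (#ab-ba^bb i)) (sym (*-identityˡ _)))
  (inj₂ (s≤s (s≤s z≤n) , refl))

length-G : ∀ w → length (G w) ≡ length w + #b w
length-G w = trans (length-#a+#b (G w))
  (trans (cong₂ _+_ (#a-G w) (#b-G w)) (cong (_+ #b w) (sym (length-#a+#b w))))

length-D : ∀ w → length (D w) ≡ length w + #a w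
length-D w = trans (length-#a+#b (D w))
  (trans (cong₂ _+_ (#a-D w) (#b-D w)) (trans (+-comm (#a w) _) (cong (_+ #a w) (sym (length-#a+#b w)))))

shrinks : ∀ {m l c k} → m ≡ l + c → 1 ≤ c → m ≤ suc k → l ≤ k
shrinks {l = l} refl c≥1 m≤1+k = ≤-pred (≤-trans (m<m+n l c≥1) m≤1+k)

MinimalFormsUpTo : ℕ → Set
MinimalFormsUpTo k = ∀ w → length w ≤ k → LocallyMinimal w → 1 ≤ #a w → 1 ≤ #b w → MinimalForm w

-- A locally minimal word either has no bb (so it is G w₀), or no aa (so it is D w₀), or both
-- (so it is aa (ba)ⁱ bb); w₀ is again locally minimal and shorter.
LM⇒MinimalForm : ∀ k → MinimalFormsUpTo k
LM⇒MinimalForm zero w len L ha hb =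
  ⊥-elim (1+n≰n (≤-trans (≤-trans ha (≤-trans (m≤m+n (#a w) (#b w)) (≤-reflexive (sym (length-#a+#b w))))) len))
LM⇒MinimalForm (suc k) w len L ha hb with hasDouble? b w | hasDouble? a w
... | no no-bb | _ with G-preimage w no-bb (starts-with-a w L ha)
...   | w₀ , refl = G-case (#a w₀) refl
  where
  hb₀ : 1 ≤ #b w₀
  hb₀ = subst (1 ≤_) (#b-G w₀) hb
  G-case : ∀ m → #a w₀ ≡ m → MinimalForm (G w₀)
  G-case zero    ♯a = G-bⁿ-minimalForm w₀ ♯a
  G-case (suc _) ♯a = G-minimalForm (LM⇒MinimalForm k w₀ (shrinks (length-G w₀) hb₀ len)
                        (G-reflects-LM w₀ L) (subst (1 ≤_) (sym ♯a) (s≤s z≤n)) hb₀)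
LM⇒MinimalForm (suc k) w len L ha hb | yes _ | no no-aa with D-preimage w no-aa (ends-with-b w L hb)
...   | w₀ , refl = D-case (#b w₀) refl
  where
  ha₀ : 1 ≤ #a w₀
  ha₀ = subst (1 ≤_) (#a-D w₀) ha
  D-case : ∀ m → #b w₀ ≡ m → MinimalForm (D w₀)
  D-case zero    ♯b = D-aⁿ-minimalForm w₀ ♯b
  D-case (suc _) ♯b = D-minimalForm (LM⇒MinimalForm k w₀ (shrinks (length-D w₀) ha₀ len)
                        (D-reflects-LM w₀ L) ha₀ (subst (1 ≤_) (sym ♯b) (s≤s z≤n)))
LM⇒MinimalForm (suc k) w len L ha hb | yes bb | yes aa with aa-and-bb⇒aa-ba^-bb w L aa bb
...   | i , refl = aa-ba^-bb-minimalForm i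

data Improvable (w : Word) : Set where
  improvable : ∀ w′ → #a w′ ≡ #a w → #b w′ ≡ #b w → mval w′ < mval w → Improvable w

StableFrom : Word → Word → Set
StableFrom x r = (∀ x₁ y → r ≡ x₁ ++ a ∷ b ∷ y → sign (reverse (x ++ x₁)) y ≢ pos) ×
                 (∀ x₁ y → r ≡ x₁ ++ b ∷ a ∷ y → sign (reverse (x ++ x₁)) y ≢ neg)

StableAt : Word → Letter → Word → Set
StableAt x l r = (∀ y → l ∷ r ≡ a ∷ b ∷ y → sign (reverse x) y ≢ pos) ×
                 (∀ y → l ∷ r ≡ b ∷ a ∷ y → sign (reverse x) y ≢ neg)

#a-swap : ∀ x y → #a (x ++ b ∷ a ∷ y) ≡ #a (x ++ a ∷ b ∷ y)
#a-swap x y = trans (#a-++ x _) (sym (#a-++ x _))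

#b-swap : ∀ x y → #b (x ++ b ∷ a ∷ y) ≡ #b (x ++ a ∷ b ∷ y)
#b-swap x y = trans (#b-++ x _) (sym (#b-++ x _))

improvable-or-stableAt : ∀ x l r → Improvable (x ++ l ∷ r) ⊎ StableAt x l r
improvable-or-stableAt x a (b ∷ y) with sign (reverse x) y in eq
... | pos = inj₁ (improvable (x ++ b ∷ a ∷ y) (#a-swap x y) (#b-swap x y) (swap-ab-improves x y eq))
... | neg = inj₂ ((λ { _ refl s → case trans (sym eq) s of λ () }) , λ { _ () })
... | zer = inj₂ ((λ { _ refl s → case trans (sym eq) s of λ () }) , λ { _ () })
improvable-or-stableAt x b (a ∷ y) with sign (reverse x) y in eq
... | neg = inj₁ (improvable (x ++ a ∷ b ∷ y) (sym (#a-swap x y)) (sym (#b-swap x y)) (swap-ba-improves x y eq))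
... | pos = inj₂ ((λ { _ () }) , λ { _ refl s → case trans (sym eq) s of λ () })
... | zer = inj₂ ((λ { _ () }) , λ { _ refl s → case trans (sym eq) s of λ () })
improvable-or-stableAt x a []      = inj₂ ((λ { _ () }) , λ { _ () })
improvable-or-stableAt x a (a ∷ r) = inj₂ ((λ { _ () }) , λ { _ () })
improvable-or-stableAt x b []      = inj₂ ((λ { _ () }) , λ { _ () })
improvable-or-stableAt x b (b ∷ r) = inj₂ ((λ { _ () }) , λ { _ () })

stableFrom-∷ : ∀ x l r → StableAt x l r → StableFrom (x ++ [ l ]) r → StableFrom x (l ∷ r)
stableFrom-∷ x l r (now-ab , now-ba) (later-ab , later-ba) = extend now-ab later-ab , extend now-ba later-ba
  where
  extend : ∀ {s t₁ t₂} → (∀ y → l ∷ r ≡ t₁ ∷ t₂ ∷ y → sign (reverse x) y ≢ s) →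
           (∀ x₁ y → r ≡ x₁ ++ t₁ ∷ t₂ ∷ y → sign (reverse ((x ++ [ l ]) ++ x₁)) y ≢ s) →
           ∀ x₁ y → l ∷ r ≡ x₁ ++ t₁ ∷ t₂ ∷ y → sign (reverse (x ++ x₁)) y ≢ s
  extend {s} now later [] y e = subst (λ z → sign (reverse z) y ≢ s) (sym (++-identityʳ x)) (now y e)
  extend {s} now later (_ ∷ x₁) y e with refl , e′ ← ∷-injective e =
    subst (λ z → sign (reverse z) y ≢ s) (++-assoc x [ l ] x₁) (later x₁ y e′)

improvable-or-stableFrom : ∀ x r → Improvable (x ++ r) ⊎ StableFrom x r
improvable-or-stableFrom x [] = inj₂ (no-site , no-site)
  where
  no-site : ∀ {l₁ l₂ s} x₁ y → [] ≡ x₁ ++ l₁ ∷ l₂ ∷ y → sign (reverse (x ++ x₁)) y ≢ s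
  no-site []      _ ()
  no-site (_ ∷ _) _ ()
improvable-or-stableFrom x (l ∷ r) with improvable-or-stableAt x l r
... | inj₁ imp = inj₁ imp
... | inj₂ now with improvable-or-stableFrom (x ++ [ l ]) r
...   | inj₁ imp   = inj₁ (subst Improvable (++-assoc x [ l ] r) imp)
...   | inj₂ later = inj₂ (stableFrom-∷ x l r now later)

improvable-or-LM : ∀ w → Improvable w ⊎ LocallyMinimal w
improvable-or-LM w with improvable-or-stableFrom [] w
... | inj₁ imp          = inj₁ imp
... | inj₂ (ab , ba) = inj₂ (record { ab-stable = ab ; ba-stable = ba })

gcd-SB : ∀ {u v p} → SternBrocot u v p → ∀ δ → gcd (u * δ) (v * δ) ≡ δ
gcd-SB {u} {v} t δ = begin
  gcd (u * δ) (v * δ) ≡⟨ cong₂ gcd (*-comm u δ) (*-comm v δ) ⟩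
  gcd (δ * u) (δ * v) ≡⟨ c*gcd[m,n]≡gcd[cm,cn] δ u v ⟨
  δ * gcd u v         ≡⟨ cong (δ *_) (coprime⇒gcd≡1 (SB-coprime t)) ⟩
  δ * 1               ≡⟨ *-identityʳ δ ⟩
  δ                   ∎
  where open ≡-Reasoning

apb-injective : ∀ p p′ → apb p ≡ apb p′ → p ≡ p′
apb-injective p p′ e = ++-cancelʳ [ b ] p p′ (∷-injectiveʳ e)

IsC⇒apb^ʷ : ∀ {u v p c} → SternBrocot u v p → ∀ δ → IsC (u * δ) (v * δ) c → c ≡ apb p ^ʷ δ
IsC⇒apb^ʷ t δ c-isC = trans (IsC⇒greedy _ _ _ c-isC) (greedy-SB t δ)

greedy-SB-1 : ∀ {u v p} → SternBrocot u v p → greedy u v ≡ apb p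
greedy-SB-1 {u} {v} {p} t = trans (cong₂ greedy (sym (*-identityʳ u)) (sym (*-identityʳ v)))
                                  (trans (greedy-SB t 1) (++-identityʳ (apb p)))

IsC⇒apb : ∀ {u v p p′} → SternBrocot u v p → IsC u v (apb p′) → p′ ≡ p
IsC⇒apb {u} {v} {p} t c-isC = apb-injective _ p (trans (IsC⇒greedy u v _ c-isC) (greedy-SB-1 t))

*-cancelʳ-pos : ∀ {x y δ} → 1 ≤ δ → x * δ ≡ y * δ → x ≡ y
*-cancelʳ-pos {x} {y} {suc δ} _ = *-cancelʳ-≡ x y (suc δ)

SB-unique : ∀ {u v p u′ v′ p′ δ δ′} → SternBrocot u v p → SternBrocot u′ v′ p′ → 1 ≤ δ →
            u * δ ≡ u′ * δ′ → v * δ ≡ v′ * δ′ → δ ≡ δ′ × p ≡ p′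
SB-unique {u} {v} {p} {u′} {v′} {p′} {δ} {δ′} t t′ pδ eu ev = δ≡δ′ , p≡p′
  where
  δ≡δ′ : δ ≡ δ′
  δ≡δ′ = trans (sym (gcd-SB t δ)) (trans (cong₂ gcd eu ev) (gcd-SB t′ δ′))
  u≡u′ : u ≡ u′
  u≡u′ = *-cancelʳ-pos pδ (trans eu (cong (u′ *_) (sym δ≡δ′)))
  v≡v′ : v ≡ v′
  v≡v′ = *-cancelʳ-pos pδ (trans ev (cong (v′ *_) (sym δ≡δ′)))
  p≡p′ : p ≡ p′
  p≡p′ = apb-injective p p′ (trans (sym (greedy-SB-1 t)) (trans (cong₂ greedy u≡u′ v≡v′) (greedy-SB-1 t′)))

MinimumAt : Word → ℕ → Word → Set
MinimumAt p δ w = mval (apb p ^ʷ δ) ≤ mval w × (mval w ≡ mval (apb p ^ʷ δ) → MinimalShape p δ w)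

mval-minimalShape : ∀ {u v p δ w} → SternBrocot u v p → MinimalShape p δ w → mval w ≡ mval (apb p ^ʷ δ)
mval-minimalShape t (inj₁ refl) = refl
mval-minimalShape {δ = 0} t (inj₂ (() , _))
mval-minimalShape {δ = 1} t (inj₂ (s≤s () , _))
mval-minimalShape {p = p} {δ = suc (suc j)} t (inj₂ (_ , refl)) = sym (mval-twin p j (SB-palindrome t))

LM-minimum : ∀ {u v p δ w} → SternBrocot u v p → 1 ≤ δ → LocallyMinimal w →
             #a w ≡ u * δ → #b w ≡ v * δ → MinimumAt p δ w
LM-minimum {w = w} t pδ L ♯a ♯b
  with LM⇒MinimalForm (length w) w ≤-refl L (subst (1 ≤_) (sym ♯a) (*-mono-≤ (proj₁ (SB-positive t)) pδ))
                                             (subst (1 ≤_) (sym ♯b) (*-mono-≤ (proj₂ (SB-positive t)) pδ))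
... | minimalForm t′ ♯a′ ♯b′ sh with SB-unique t t′ pδ (trans (sym ♯a) ♯a′) (trans (sym ♯b) ♯b′)
...   | refl , refl = ≤-reflexive (sym (mval-minimalShape t sh)) , λ _ → sh

mval-minimum-below : ∀ {u v p δ} → SternBrocot u v p → 1 ≤ δ → ∀ k w → mval w ≤ k →
                     #a w ≡ u * δ → #b w ≡ v * δ → MinimumAt p δ w
mval-minimum-below t pδ k w m≤k ♯a ♯b with improvable-or-LM w
... | inj₂ L = LM-minimum t pδ L ♯a ♯b
... | inj₁ (improvable w′ ♯a′ ♯b′ m′<m) with k
...   | zero = ⊥-elim (n≮0 (≤-trans m′<m m≤k))
...   | suc k′ with mval-minimum-below t pδ k′ w′ (≤-pred (≤-trans m′<m m≤k)) (trans ♯a′ ♯a) (trans ♯b′ ♯b)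
...     | min′ , _ = ≤-trans min′ (<⇒≤ m′<m) , λ eq → ⊥-elim (<⇒≱ (≤-<-trans min′ m′<m) (≤-reflexive eq))

record EuclidData (d n : ℕ) : Set where
  constructor euclidData
  field
    {u v δ} : ℕ
    {p}     : Word
    tree    : SternBrocot u v p
    δ-pos   : 1 ≤ δ
    d≡      : d ≡ u * δ
    n≡      : n ≡ v * δ

euclid : ∀ k d n → d + n ≤ k → 1 ≤ d → 1 ≤ n → EuclidData d n
euclid zero d n d+n≤0 hd _ = ⊥-elim (1+n≰n (≤-trans (≤-trans hd (m≤m+n d n)) d+n≤0))
euclid (suc k) d n d+n≤k hd hn with <-cmp d n
... | tri≈ _ refl _ = euclidData root hd (sym (*-identityˡ d)) (sym (*-identityˡ d))
... | tri> _ _ n<d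
  with euclidData {u} {v} {δ} t pδ d∸n≡ n≡ ← euclid k (d ∸ n) n
         (subst (_≤ k) (sym (m∸n+n≡m (<⇒≤ n<d))) (shrinks refl hn d+n≤k)) (m<n⇒0<n∸m n<d) hn =
  euclidData (G-step t) pδ
    (trans (sym (m∸n+n≡m (<⇒≤ n<d))) (trans (cong₂ _+_ d∸n≡ n≡) (sym (*-distribʳ-+ δ u v)))) n≡
euclid (suc k) d n d+n≤k hd hn | tri< d<n _ _
  with euclidData {u} {v} {δ} t pδ d≡ n∸d≡ ← euclid k d (n ∸ d)
         (subst (_≤ k) (sym (m+[n∸m]≡n (<⇒≤ d<n))) (shrinks (+-comm d n) hd d+n≤k)) hd (m<n⇒0<n∸m d<n) =
  euclidData (D-step t) pδ d≡
    (trans (sym (m+[n∸m]≡n (<⇒≤ d<n))) (trans (cong₂ _+_ d≡ n∸d≡) (sym (*-distribʳ-+ δ u v))))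

zero-or-euclid : ∀ d n → d ≡ 0 ⊎ n ≡ 0 ⊎ EuclidData d n
zero-or-euclid zero    n       = inj₁ refl
zero-or-euclid (suc d) zero    = inj₂ (inj₁ refl)
zero-or-euclid (suc d) (suc n) = inj₂ (inj₂ (euclid _ (suc d) (suc n) ≤-refl (s≤s z≤n) (s≤s z≤n)))

IsC-without-a : ∀ {n c w} → IsC 0 n c → #a w ≡ 0 → #b w ≡ n → c ≡ w
IsC-without-a c-isC ♯a ♯b =
  #a≡0-unique _ _ (proj₁ (IsC.ends c-isC)) ♯a (trans (proj₂ (IsC.ends c-isC)) (sym ♯b))

IsC-without-b : ∀ {d c w} → IsC d 0 c → #a w ≡ d → #b w ≡ 0 → c ≡ w
IsC-without-b c-isC ♯a ♯b =
  #b≡0-unique _ _ (proj₂ (IsC.ends c-isC)) ♯b (trans (proj₁ (IsC.ends c-isC)) (sym ♯a))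

christoffel-minimum : ∀ {u v p δ w c} → SternBrocot u v p → 1 ≤ δ →
  #a w ≡ u * δ → #b w ≡ v * δ → IsC (u * δ) (v * δ) c → mval c ≤ mval w
christoffel-minimum {δ = δ} {w} t pδ ♯a ♯b c-isC rewrite IsC⇒apb^ʷ t δ c-isC =
  proj₁ (mval-minimum-below t pδ (mval w) w ≤-refl ♯a ♯b)

christoffel-equality : ∀ {u v p δ w c} → SternBrocot u v p → 1 ≤ δ →
  #a w ≡ u * δ → #b w ≡ v * δ → IsC (u * δ) (v * δ) c →
  (u′ v′ : ℕ) → u * δ ≡ u′ * gcd (u * δ) (v * δ) → v * δ ≡ v′ * gcd (u * δ) (v * δ) →
  (p′ : Word) → Palindrome p′ → IsC u′ v′ (a ∷ p′ ++ [ b ]) →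
  (mval w ≡ mval c ⇔
    (w ≡ c ⊎
      (2 ≤ gcd (u * δ) (v * δ) ×
       w ≡ (a ∷ p′ ++ [ a ]) ++ ((b ∷ p′ ++ [ a ]) ^ʷ (gcd (u * δ) (v * δ) ∸ 2)) ++ (b ∷ p′ ++ [ b ]))))
christoffel-equality {δ = δ} {w = w} t pδ ♯a ♯b c-isC u′ v′ eu ev p′ _ p′-isC
  rewrite gcd-SB t δ | IsC⇒apb^ʷ t δ c-isC
  with refl ← IsC⇒apb t (subst₂ (λ x y → IsC x y (apb p′)) (sym (*-cancelʳ-pos pδ eu)) (sym (*-cancelʳ-pos pδ ev))
                                 p′-isC) =
  mk⇔ (proj₂ (mval-minimum-below t pδ (mval w) w ≤-refl ♯a ♯b)) (mval-minimalShape t)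

proposition3p5 : (d n : ℕ) (w : Word) → #a w ≡ d → #b w ≡ n →
  (c : Word) → IsC d n c →
  (mval c ≤ mval w) ×
  (1 ≤ d → 1 ≤ n → (u v : ℕ) → d ≡ u * gcd d n → n ≡ v * gcd d n →
    (p : Word) → Palindrome p → IsC u v (a ∷ p ++ [ b ]) →
    (mval w ≡ mval c ⇔
      (w ≡ c ⊎
        (2 ≤ gcd d n ×
         w ≡ (a ∷ p ++ [ a ]) ++ ((b ∷ p ++ [ a ]) ^ʷ (gcd d n ∸ 2)) ++ (b ∷ p ++ [ b ])))))
proposition3p5 d n w ♯a ♯b c c-isC with zero-or-euclid d n
... | inj₁ refl        = ≤-reflexive (cong mval (IsC-without-a {w = w} c-isC ♯a ♯b)) , λ ()
... | inj₂ (inj₁ refl) = ≤-reflexive (cong mval (IsC-without-b {w = w} c-isC ♯a ♯b)) , λ _ ()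
... | inj₂ (inj₂ (euclidData t pδ refl refl)) =
  christoffel-minimum {w = w} t pδ ♯a ♯b c-isC , λ _ _ → christoffel-equality {w = w} t pδ ♯a ♯b c-isC
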